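{- Let $q\geqslant2$ be an even integer and $n\geqslant2$ an even integer. Let $\mathrm{SB}^{+}_{\mathcal{GM}^q}(n)$ (respectively $\mathrm{SB}^{ - }_{\mathcal{GM}^q}(n)$) be the set of self-dual (respectively anti-self-dual) functions $f:\mathbb{F}_2^{n/2}\times\mathbb{F}_2^{n/2}\to\mathbb{Z}_q$ of the form $f(x,y)=\frac q2\langle x,\pi(y)\rangle+g(y)$ with $\pi$ a permutation of $\mathbb{F}_2^{n/2}$ and $g:\mathbb{F}_2^{n/2}\to\mathbb{Z}_q$. Then $$|\mathrm{SB}^{+}_{\mathcal{GM}^q}(n)|=|\mathrm{SB}^{ - }_{\mathcal{GM}^q}(n)|=q\cdot 2^{n/2-1}\,|\mathcal{O}(n/2,\mathbb{F}_2)|.$$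
   Context: $\mathcal{O}(m,\mathbb{F}_2)=\{L\in\mathrm{GL}(m,\mathbb{F}_2): LL^T=I_m\}$. With $\omega=e^{2\pi i/q}$, the generalized Walsh–Hadamard transform of $f:\mathbb{F}_2^n\to\mathbb{Z}_q$ is $H_f(u)=\sum_{x}\omega^{f(x)}(-1)^{\langle x,u\rangle}$; $f$ is regular gbent with dual $\widetilde f$ if $H_f(u)=2^{n/2}\omega^{\widetilde f(u)}$ for all $u$; self-dual means $\widetilde f=f$, anti-self-dual means $\widetilde f=f+q/2$. -}

module Defs where

open import Level using (Level; _⊔_)
open import Data.Bool using (Bool; true; false; _∧_; _xor_; if_then_else_)
open import Data.Nat using (ℕ; zero; suc; _<_; NonZero)
import Data.Nat as ℕ
open import Data.Nat.DivMod using (_mod_)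
open import Data.Fin using (Fin; toℕ)
open import Data.Fin.Properties using () renaming (_≟_ to _≟ᶠ_)
open import Data.Vec using (Vec; []; _∷_; foldr; zipWith; tabulate; lookup)
open import Data.List using (List; []; _∷_; map; concatMap; _++_)
open import Data.Product using (Σ; ∃; _×_; _,_)
open import Data.Sum using (_⊎_)
open import Relation.Nullary using (¬_; does)
open import Relation.Binary.PropositionalEquality using (_≡_)
open import Function.Definitions using (Bijective)
open import Algebra.Bundles using (CommutativeRing)

F2 : ℕ → Set
F2 m = Vec Bool m

⟨_,_⟩ : ∀ {m} → F2 m → F2 m → Bool
⟨ x , u ⟩ = foldr _ _xor_ false (zipWith _∧_ x u)

b2n : Bool → ℕ
b2n true = 1
b2n false = 0

allF2 : (m : ℕ) → List (F2 m)
allF2 zero = [] ∷ []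
allF2 (suc m) = map (false ∷_) (allF2 m) ++ map (true ∷_) (allF2 m)

-- Z_q represented as Fin q; functions F_2^{m} × F_2^{m} → Z_q (curried)
Fun2 : ℕ → ℕ → Set
Fun2 m q = F2 m → F2 m → Fin q

_≗₂_ : ∀ {m q} → Fun2 m q → Fun2 m q → Set
f ≗₂ g = ∀ x y → f x y ≡ g x y

Mat : ℕ → Set
Mat m = Fin m → Fin m → Bool

_≐_ : ∀ {m} → Mat m → Mat m → Set
L ≐ M = ∀ i j → L i j ≡ M i j

_·_ : ∀ {m} → Mat m → Mat m → Mat m
(L · M) i j = ⟨ tabulate (L i) , tabulate (λ k → M k j) ⟩

transpose : ∀ {m} → Mat m → Mat m
transpose L i j = L j i

I : ∀ {m} → Mat m
I i j = does (i ≟ᶠ j)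

IsInvertible : ∀ {m} → Mat m → Set
IsInvertible L = ∃ λ M → ((L · M) ≐ I) × ((M · L) ≐ I)

IsOrthogonal : ∀ {m} → Mat m → Set
IsOrthogonal L = IsInvertible L × ((L · transpose L) ≐ I)

-- Finite cardinality of the subset {a | P a} of A, elements compared up to ≈:
-- an enumeration without repetitions (up to ≈) covering every a with P a.
HasCard : ∀ {a p r} {A : Set a} (_≈_ : A → A → Set r) (P : A → Set p) (N : ℕ) → Set (a ⊔ p ⊔ r)
HasCard {A = A} _≈_ P N =
  Σ (Vec A N) λ v →
    (∀ i → P (lookup v i)) ×
    (∀ i j → lookup v i ≈ lookup v j → i ≡ j) ×
    (∀ x → P x → ∃ λ i → x ≈ lookup v i)

IsGMM : ∀ {m} (q : ℕ) .{{_ : NonZero q}} (half : ℕ) → Fun2 m q → Set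
IsGMM {m} q half f =
  Σ (F2 m → F2 m) λ π → Bijective _≡_ _≡_ π ×
  Σ (F2 m → Fin q) λ g →
    ∀ x y → f x y ≡ ((half ℕ.* b2n ⟨ x , π y ⟩ ℕ.+ toℕ (g y)) mod q)

module WithRing {c ℓ} (R : CommutativeRing c ℓ) where
  open CommutativeRing R

  natR : ℕ → Carrier
  natR zero = 0#
  natR (suc k) = 1# + natR k

  pow : Carrier → ℕ → Carrier
  pow w zero = 1#
  pow w (suc k) = w * pow w k

  IsCharZeroDomain : Set (c ⊔ ℓ)
  IsCharZeroDomain =
    (∀ k → ¬ (natR (suc k) ≈ 0#)) ×
    (∀ a b → (a * b) ≈ 0# → (a ≈ 0#) ⊎ (b ≈ 0#))

  IsPrimitiveRoot : ℕ → Carrier → Set ℓ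
  IsPrimitiveRoot q w = (pow w q ≈ 1#) × (∀ k → 0 < k → k < q → ¬ (pow w k ≈ 1#))

  sumR : ∀ {A : Set} → List A → (A → Carrier) → Carrier
  sumR [] h = 0#
  sumR (a ∷ as) h = h a + sumR as h

  sgn : Bool → Carrier
  sgn b = if b then - 1# else 1#

  -- generalized Walsh–Hadamard transform on F_2^m × F_2^m ≅ F_2^{2m}
  H : ∀ {m q} → Carrier → Fun2 m q → F2 m → F2 m → Carrier
  H {m} w f u v =
    sumR (allF2 m) λ x → sumR (allF2 m) λ y →
      pow w (toℕ (f x y)) * sgn (⟨ x , u ⟩ xor ⟨ y , v ⟩)

  -- self-dual: H_f(u) = 2^{n/2} ω^{f(u)}  (here n/2 = m)
  IsSelfDual : ∀ {m q} → Carrier → Fun2 m q → Set ℓ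
  IsSelfDual {m} w f = ∀ u v → H w f u v ≈ (natR (2 ℕ.^ m) * pow w (toℕ (f u v)))

  IsAntiSelfDual : ∀ {m} (q : ℕ) .{{_ : NonZero q}} (half : ℕ) → Carrier → Fun2 m q → Set ℓ
  IsAntiSelfDual {m} q half w f =
    ∀ u v → H w f u v ≈ (natR (2 ℕ.^ m) * pow w (toℕ ((toℕ (f u v) ℕ.+ half) mod q)))

  SBplus : ∀ m (q : ℕ) .{{_ : NonZero q}} → Carrier → Fun2 m q → Set ℓ
  SBplus m q w f = IsSelfDual w f × IsGMM q (q ℕ./ 2) f

  SBminus : ∀ m (q : ℕ) .{{_ : NonZero q}} → Carrier → Fun2 m q → Set ℓ
  SBminus m q w f = IsAntiSelfDual q (q ℕ./ 2) w f × IsGMM q (q ℕ./ 2) f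

{-# OPTIONS --safe #-}
module Submission where

-- Write f(x, y) = (q/2)⟨x, π y⟩ + g(y), so that ω^f(x,y) = (-1)^⟨x, π y⟩ ω^g(y). Summing over x first,
-- the orthogonality of the characters (-1)^⟨x, u⟩ collapses the Walsh-Hadamard transform to
-- H_f(π w, v) = 2^(n/2) ω^g(w) (-1)^⟨w, v⟩. Hence f is self-dual (e = 0) or anti-self-dual (e = 1) iff
-- ω^g(w) (-1)^⟨w, v⟩ = (-1)^(⟨π w, π v⟩ + e) ω^g(v) for all w, v. The case v = 0 forces
-- g(w) = c + (q/2)⟨π w, a⟩ with a = π 0, and then the condition says exactly that ⟨a, a⟩ = e and that
-- y ↦ π y + a preserves the inner product, i.e. is an orthogonal matrix L. So (c, a, L) ↦ f is a bijection
-- from Z_q × {a : ⟨a, a⟩ = e} × O(n/2, F_2) onto SB^±, and there are 2^(n/2 - 1) such a, since the first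
-- coordinate of a is determined by the others.

open import Defs
open import Algebra.Bundles using (CommutativeRing)
open import Data.Nat using (ℕ; NonZero; _≤_)
import Data.Nat as ℕ
open import Relation.Binary.PropositionalEquality using (_≡_)

module F₂LinearAlgebra where

  open import Function using (_∘_; _⇔_; mk⇔; Equivalence)
  open import Data.Bool using (Bool; false; _∧_; _xor_)
  open import Data.Bool.Properties
    using (xor-assoc; xor-identityˡ; xor-identityʳ; xor-same; ∧-comm; ∧-assoc; ∧-zeroʳ;
           ∧-distribˡ-xor; ∧-distribʳ-xor; xor-∧-commutativeRing)
  open import Data.Bool.Solver using (module xor-∧-Solver)
  open import Data.Nat using (zero; suc)
  open import Data.Fin using (Fin; zero; suc)
  open import Data.Fin.Properties using () renaming (_≟_ to _≟ᶠ_)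
  open import Data.Vec using (Vec; []; _∷_; zipWith; tabulate; lookup; replicate)
  open import Data.Vec.Properties
    using (lookup∘tabulate; tabulate∘lookup; tabulate-cong; lookup-replicate; zipWith-identityˡ)
  open import Relation.Nullary using (does)
  open import Relation.Binary.PropositionalEquality
  open import Algebra.Properties.CommutativeSemigroup
    (CommutativeRing.+-commutativeSemigroup xor-∧-commutativeRing) using () renaming (interchange to xor-interchange)
  open import Algebra.Properties.CommutativeSemigroup
    (CommutativeRing.*-commutativeSemigroup xor-∧-commutativeRing)
    using () renaming (xy∙z≈y∙xz to ∧-xy∙z≈y∙xz)
  open ≡-Reasoning

  xor-cancelʳ : ∀ x y → (x xor y) xor y ≡ x
  xor-cancelʳ x y = trans (xor-assoc x y y) (trans (cong (x xor_) (xor-same y)) (xor-identityʳ x))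

  ⨁ : ∀ {m} → (Fin m → Bool) → Bool
  ⨁ {zero}  f = false
  ⨁ {suc m} f = f zero xor ⨁ (f ∘ suc)

  ⨁-cong : ∀ {m} {f g : Fin m → Bool} → (∀ i → f i ≡ g i) → ⨁ f ≡ ⨁ g
  ⨁-cong {zero}  f≗g = refl
  ⨁-cong {suc m} f≗g = cong₂ _xor_ (f≗g zero) (⨁-cong (f≗g ∘ suc))

  ⨁-false : ∀ m → ⨁ {m} (λ _ → false) ≡ false
  ⨁-false zero    = refl
  ⨁-false (suc m) = ⨁-false m

  ⨁-distrib-xor : ∀ {m} (f g : Fin m → Bool) → ⨁ (λ i → f i xor g i) ≡ ⨁ f xor ⨁ g
  ⨁-distrib-xor {zero}  f g = refl
  ⨁-distrib-xor {suc m} f g = trans (cong ((f zero xor g zero) xor_) (⨁-distrib-xor (f ∘ suc) (g ∘ suc)))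
    (xor-interchange (f zero) (g zero) (⨁ (f ∘ suc)) (⨁ (g ∘ suc)))

  ⨁-distribˡ-∧ : ∀ {m} b (f : Fin m → Bool) → b ∧ ⨁ f ≡ ⨁ (λ i → b ∧ f i)
  ⨁-distribˡ-∧ {zero}  b f = ∧-zeroʳ b
  ⨁-distribˡ-∧ {suc m} b f =
    trans (∧-distribˡ-xor b (f zero) (⨁ (f ∘ suc))) (cong ((b ∧ f zero) xor_) (⨁-distribˡ-∧ b (f ∘ suc)))

  ⨁-distribʳ-∧ : ∀ {m} b (f : Fin m → Bool) → ⨁ f ∧ b ≡ ⨁ (λ i → f i ∧ b)
  ⨁-distribʳ-∧ b f = trans (∧-comm (⨁ f) b) (trans (⨁-distribˡ-∧ b f) (⨁-cong (λ i → ∧-comm b (f i))))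

  ⨁-comm : ∀ {m k} (f : Fin m → Fin k → Bool) → ⨁ (λ i → ⨁ (f i)) ≡ ⨁ (λ j → ⨁ (λ i → f i j))
  ⨁-comm {zero}  {k} f = sym (⨁-false k)
  ⨁-comm {suc m} {k} f = trans (cong (⨁ (f zero) xor_) (⨁-comm (f ∘ suc)))
    (sym (⨁-distrib-xor (f zero) (λ j → ⨁ (λ i → f (suc i) j))))

  ⨁-select : ∀ {m} (i : Fin m) (g : Fin m → Bool) → ⨁ (λ j → does (i ≟ᶠ j) ∧ g j) ≡ g i
  ⨁-select {suc m} zero    g = trans (cong (g zero xor_) (⨁-false m)) (xor-identityʳ (g zero))
  ⨁-select {suc m} (suc i) g = ⨁-select i (g ∘ suc)

  lookup-ext : ∀ {a} {A : Set a} {m} {x y : Vec A m} → (∀ i → lookup x i ≡ lookup y i) → x ≡ y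
  lookup-ext {x = x} {y} x≗y = trans (sym (tabulate∘lookup x)) (trans (tabulate-cong x≗y) (tabulate∘lookup y))

  infixl 6 _⊕_
  _⊕_ : ∀ {m} → F2 m → F2 m → F2 m
  _⊕_ = zipWith _xor_

  0ᵥ : ∀ {m} → F2 m
  0ᵥ {m} = replicate m false

  basis : ∀ {m} → Fin m → F2 m
  basis j = tabulate (λ i → does (j ≟ᶠ i))

  ⊕-identityˡ : ∀ {m} (x : F2 m) → 0ᵥ ⊕ x ≡ x
  ⊕-identityˡ = zipWith-identityˡ xor-identityˡ

  ⊕-cancelʳ : ∀ {m} (x a : F2 m) → x ⊕ a ⊕ a ≡ x
  ⊕-cancelʳ []      []      = refl
  ⊕-cancelʳ (b ∷ x) (c ∷ a) = cong₂ _∷_ (xor-cancelʳ b c) (⊕-cancelʳ x a)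

  ⊕-cancelʳ-≡ : ∀ {m} {x y : F2 m} (a : F2 m) → x ⊕ a ≡ y ⊕ a → x ≡ y
  ⊕-cancelʳ-≡ {x = x} {y} a eq = begin
    x         ≡⟨ ⊕-cancelʳ x a ⟨
    x ⊕ a ⊕ a ≡⟨ cong (_⊕ a) eq ⟩
    y ⊕ a ⊕ a ≡⟨ ⊕-cancelʳ y a ⟩
    y         ∎

  ⟨⟩-⨁ : ∀ {m} (x y : F2 m) → ⟨ x , y ⟩ ≡ ⨁ (λ i → lookup x i ∧ lookup y i)
  ⟨⟩-⨁ []      []      = refl
  ⟨⟩-⨁ (a ∷ x) (b ∷ y) = cong ((a ∧ b) xor_) (⟨⟩-⨁ x y)

  ⟨⟩-comm : ∀ {m} (x y : F2 m) → ⟨ x , y ⟩ ≡ ⟨ y , x ⟩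
  ⟨⟩-comm []      []      = refl
  ⟨⟩-comm (a ∷ x) (b ∷ y) = cong₂ _xor_ (∧-comm a b) (⟨⟩-comm x y)

  ⟨⟩-distribʳ-⊕ : ∀ {m} (z x y : F2 m) → ⟨ x ⊕ y , z ⟩ ≡ ⟨ x , z ⟩ xor ⟨ y , z ⟩
  ⟨⟩-distribʳ-⊕ []      []      []      = refl
  ⟨⟩-distribʳ-⊕ (c ∷ z) (a ∷ x) (b ∷ y) =
    trans (cong₂ _xor_ (∧-distribʳ-xor c a b) (⟨⟩-distribʳ-⊕ z x y))
          (xor-interchange (a ∧ c) (b ∧ c) ⟨ x , z ⟩ ⟨ y , z ⟩)

  ⟨⟩-distribˡ-⊕ : ∀ {m} (z x y : F2 m) → ⟨ z , x ⊕ y ⟩ ≡ ⟨ z , x ⟩ xor ⟨ z , y ⟩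
  ⟨⟩-distribˡ-⊕ z x y = begin
    ⟨ z , x ⊕ y ⟩             ≡⟨ ⟨⟩-comm z (x ⊕ y) ⟩
    ⟨ x ⊕ y , z ⟩             ≡⟨ ⟨⟩-distribʳ-⊕ z x y ⟩
    ⟨ x , z ⟩ xor ⟨ y , z ⟩ ≡⟨ cong₂ _xor_ (⟨⟩-comm x z) (⟨⟩-comm y z) ⟩
    ⟨ z , x ⟩ xor ⟨ z , y ⟩ ∎

  ⟨⟩-zeroʳ : ∀ {m} (x : F2 m) → ⟨ x , 0ᵥ ⟩ ≡ false
  ⟨⟩-zeroʳ []      = refl
  ⟨⟩-zeroʳ (a ∷ x) = cong₂ _xor_ (∧-zeroʳ a) (⟨⟩-zeroʳ x)

  ⟨⟩-zeroˡ : ∀ {m} (x : F2 m) → ⟨ 0ᵥ , x ⟩ ≡ false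
  ⟨⟩-zeroˡ x = trans (⟨⟩-comm 0ᵥ x) (⟨⟩-zeroʳ x)

  ⟨x⊕a,y⊕a⟩ : ∀ {m} (x y a : F2 m) →
    ⟨ x ⊕ a , y ⊕ a ⟩ ≡ ((⟨ x , y ⟩ xor ⟨ x , a ⟩) xor ⟨ y , a ⟩) xor ⟨ a , a ⟩
  ⟨x⊕a,y⊕a⟩ x y a = begin
    ⟨ x ⊕ a , y ⊕ a ⟩
      ≡⟨ ⟨⟩-distribʳ-⊕ (y ⊕ a) x a ⟩
    ⟨ x , y ⊕ a ⟩ xor ⟨ a , y ⊕ a ⟩
      ≡⟨ cong₂ _xor_ (⟨⟩-distribˡ-⊕ x y a)
                     (trans (⟨⟩-distribˡ-⊕ a y a) (cong (_xor ⟨ a , a ⟩) (⟨⟩-comm a y))) ⟩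
    (⟨ x , y ⟩ xor ⟨ x , a ⟩) xor (⟨ y , a ⟩ xor ⟨ a , a ⟩)
      ≡⟨ xor-assoc (⟨ x , y ⟩ xor ⟨ x , a ⟩) ⟨ y , a ⟩ ⟨ a , a ⟩ ⟨
    ((⟨ x , y ⟩ xor ⟨ x , a ⟩) xor ⟨ y , a ⟩) xor ⟨ a , a ⟩ ∎

  ⟨basis,x⟩≡lookup : ∀ {m} (j : Fin m) (x : F2 m) → ⟨ basis j , x ⟩ ≡ lookup x j
  ⟨basis,x⟩≡lookup j x = trans (⟨⟩-⨁ (basis j) x)
    (trans (⨁-cong (λ i → cong (_∧ lookup x i) (lookup∘tabulate _ i))) (⨁-select j (lookup x)))

  ⟨⟩-nondegenerate : ∀ {m} {x y : F2 m} → (∀ z → ⟨ z , x ⟩ ≡ ⟨ z , y ⟩) → x ≡ y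
  ⟨⟩-nondegenerate {x = x} {y} x∼y =
    lookup-ext (λ i → trans (sym (⟨basis,x⟩≡lookup i x)) (trans (x∼y (basis i)) (⟨basis,x⟩≡lookup i y)))

  infixr 7 _▹_
  _▹_ : ∀ {m} → Mat m → F2 m → F2 m
  A ▹ x = tabulate (λ i → ⟨ tabulate (A i) , x ⟩)

  lookup-▹ : ∀ {m} (A : Mat m) (x : F2 m) i → lookup (A ▹ x) i ≡ ⨁ (λ j → A i j ∧ lookup x j)
  lookup-▹ A x i = trans (lookup∘tabulate _ i) (trans (⟨⟩-⨁ (tabulate (A i)) x)
    (⨁-cong (λ j → cong (_∧ lookup x j) (lookup∘tabulate (A i) j))))

  ·-entry : ∀ {m} (A B : Mat m) i j → (A · B) i j ≡ ⨁ (λ k → A i k ∧ B k j)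
  ·-entry A B i j = trans (⟨⟩-⨁ (tabulate (A i)) (tabulate (λ k → B k j)))
    (⨁-cong (λ k → cong₂ _∧_ (lookup∘tabulate (A i) k) (lookup∘tabulate (λ k → B k j) k)))

  ▹-cong : ∀ {m} {A B : Mat m} → A ≐ B → ∀ x → A ▹ x ≡ B ▹ x
  ▹-cong A≐B x = tabulate-cong (λ i → cong (λ r → ⟨ r , x ⟩) (tabulate-cong (A≐B i)))

  ▹-zeroʳ : ∀ {m} (A : Mat m) → A ▹ 0ᵥ ≡ 0ᵥ
  ▹-zeroʳ A = lookup-ext (λ i →
    trans (lookup∘tabulate _ i) (trans (⟨⟩-zeroʳ (tabulate (A i))) (sym (lookup-replicate i false))))

  I-▹ : ∀ {m} (x : F2 m) → I ▹ x ≡ x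
  I-▹ x = lookup-ext (λ i → trans (lookup-▹ I x i) (⨁-select i (lookup x)))

  ·-▹ : ∀ {m} (A B : Mat m) (x : F2 m) → (A · B) ▹ x ≡ A ▹ (B ▹ x)
  ·-▹ A B x = lookup-ext λ i → begin
    lookup ((A · B) ▹ x) i
      ≡⟨ lookup-▹ (A · B) x i ⟩
    ⨁ (λ j → (A · B) i j ∧ lookup x j)
      ≡⟨ ⨁-cong (λ j → trans (cong (_∧ lookup x j) (·-entry A B i j))
                              (⨁-distribʳ-∧ (lookup x j) (λ k → A i k ∧ B k j))) ⟩
    ⨁ (λ j → ⨁ (λ k → (A i k ∧ B k j) ∧ lookup x j))
      ≡⟨ ⨁-comm (λ j k → (A i k ∧ B k j) ∧ lookup x j) ⟩
    ⨁ (λ k → ⨁ (λ j → (A i k ∧ B k j) ∧ lookup x j))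
      ≡⟨ ⨁-cong (λ k → trans (⨁-cong (λ j → ∧-assoc (A i k) (B k j) (lookup x j)))
                                (sym (⨁-distribˡ-∧ (A i k) (λ j → B k j ∧ lookup x j)))) ⟩
    ⨁ (λ k → A i k ∧ ⨁ (λ j → B k j ∧ lookup x j))
      ≡⟨ ⨁-cong (λ k → cong (A i k ∧_) (lookup-▹ B x k)) ⟨
    ⨁ (λ k → A i k ∧ lookup (B ▹ x) k)
      ≡⟨ lookup-▹ A (B ▹ x) i ⟨
    lookup (A ▹ (B ▹ x)) i ∎

  transpose-adjoint : ∀ {m} (A : Mat m) (x y : F2 m) → ⟨ A ▹ x , y ⟩ ≡ ⟨ x , transpose A ▹ y ⟩
  transpose-adjoint A x y = begin
    ⟨ A ▹ x , y ⟩
      ≡⟨ ⟨⟩-⨁ (A ▹ x) y ⟩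
    ⨁ (λ i → lookup (A ▹ x) i ∧ lookup y i)
      ≡⟨ ⨁-cong (λ i → trans (cong (_∧ lookup y i) (lookup-▹ A x i))
                              (⨁-distribʳ-∧ (lookup y i) (λ j → A i j ∧ lookup x j))) ⟩
    ⨁ (λ i → ⨁ (λ j → (A i j ∧ lookup x j) ∧ lookup y i))
      ≡⟨ ⨁-comm (λ i j → (A i j ∧ lookup x j) ∧ lookup y i) ⟩
    ⨁ (λ j → ⨁ (λ i → (A i j ∧ lookup x j) ∧ lookup y i))
      ≡⟨ ⨁-cong (λ j → trans (⨁-cong (λ i → ∧-xy∙z≈y∙xz (A i j) (lookup x j) (lookup y i)))
                                (sym (⨁-distribˡ-∧ (lookup x j) (λ i → A i j ∧ lookup y i)))) ⟩
    ⨁ (λ j → lookup x j ∧ ⨁ (λ i → A i j ∧ lookup y i))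
      ≡⟨ ⨁-cong (λ j → cong (lookup x j ∧_) (lookup-▹ (transpose A) y j)) ⟨
    ⨁ (λ j → lookup x j ∧ lookup (transpose A ▹ y) j)
      ≡⟨ ⟨⟩-⨁ x (transpose A ▹ y) ⟨
    ⟨ x , transpose A ▹ y ⟩ ∎

  ≐-from-▹ : ∀ {m} {A B : Mat m} → (∀ x → A ▹ x ≡ B ▹ x) → A ≐ B
  ≐-from-▹ {A = A} {B} A▹≗B▹ i j =
    trans (sym (column A)) (trans (cong (λ v → lookup v i) (A▹≗B▹ (basis j))) (column B))
    where
    column : ∀ C → lookup (C ▹ basis j) i ≡ C i j
    column C = trans (lookup∘tabulate _ i) (trans (⟨⟩-comm (tabulate (C i)) (basis j))
      (trans (⟨basis,x⟩≡lookup j (tabulate (C i))) (lookup∘tabulate (C i) j)))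

  SignCondition : ∀ {m} → Bool → (F2 m → F2 m) → F2 m → Set
  SignCondition e π a = ∀ w v → ⟨ π w , a ⟩ xor ⟨ w , v ⟩ ≡ (⟨ π w , π v ⟩ xor ⟨ π v , a ⟩) xor e

  SignCondition⇒⟨a,a⟩≡e : ∀ {m} {e} {π : F2 m → F2 m} →
    SignCondition e π (π 0ᵥ) → ⟨ π 0ᵥ , π 0ᵥ ⟩ ≡ e
  SignCondition⇒⟨a,a⟩≡e {m} {e} {π} condition = begin
    ⟨ a , a ⟩                           ≡⟨ xor-identityʳ ⟨ a , a ⟩ ⟨
    ⟨ a , a ⟩ xor false                 ≡⟨ cong (⟨ a , a ⟩ xor_) (⟨⟩-zeroʳ o) ⟨
    ⟨ a , a ⟩ xor ⟨ o , o ⟩             ≡⟨ condition o o ⟩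
    (⟨ a , a ⟩ xor ⟨ a , a ⟩) xor e     ≡⟨ cong (_xor e) (xor-same ⟨ a , a ⟩) ⟩
    e                                   ∎
    where
    o = 0ᵥ {m}
    a = π o

  xor-move : ∀ P X Y E W → (X xor W ≡ (P xor Y) xor E) ⇔ (W ≡ ((P xor X) xor Y) xor E)
  xor-move P X Y E W = mk⇔
    (λ XW≡PYE → begin
      W                        ≡⟨ solve 2 (λ X W → W := X :+ (X :+ W)) refl X W ⟩
      X xor (X xor W)          ≡⟨ cong (X xor_) XW≡PYE ⟩
      X xor ((P xor Y) xor E)  ≡⟨ solve 4 (λ P X Y E → X :+ ((P :+ Y) :+ E) := ((P :+ X) :+ Y) :+ E) refl P X Y E ⟩
      ((P xor X) xor Y) xor E  ∎)
    (λ W≡PXYE → trans (cong (X xor_) W≡PXYE)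
      (solve 4 (λ P X Y E → X :+ (((P :+ X) :+ Y) :+ E) := (P :+ Y) :+ E) refl P X Y E))
    where open xor-∧-Solver

  SignCondition⇔isometry : ∀ {m} {e} {π : F2 m → F2 m} {a} → ⟨ a , a ⟩ ≡ e →
    SignCondition e π a ⇔ (∀ w v → ⟨ π w ⊕ a , π v ⊕ a ⟩ ≡ ⟨ w , v ⟩)
  SignCondition⇔isometry {e = e} {π} {a} ⟨a,a⟩≡e = mk⇔
    (λ condition w v → trans (expand w v) (sym (Equivalence.to (move w v) (condition w v))))
    (λ isometry w v → Equivalence.from (move w v) (trans (sym (isometry w v)) (expand w v)))
    where
    move : ∀ w v → (⟨ π w , a ⟩ xor ⟨ w , v ⟩ ≡ (⟨ π w , π v ⟩ xor ⟨ π v , a ⟩) xor e) ⇔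
                   (⟨ w , v ⟩ ≡ ((⟨ π w , π v ⟩ xor ⟨ π w , a ⟩) xor ⟨ π v , a ⟩) xor e)
    move w v = xor-move ⟨ π w , π v ⟩ ⟨ π w , a ⟩ ⟨ π v , a ⟩ e ⟨ w , v ⟩
    expand : ∀ w v → ⟨ π w ⊕ a , π v ⊕ a ⟩ ≡ ((⟨ π w , π v ⟩ xor ⟨ π w , a ⟩) xor ⟨ π v , a ⟩) xor e
    expand w v = trans (⟨x⊕a,y⊕a⟩ (π w) (π v) a)
      (cong (((⟨ π w , π v ⟩ xor ⟨ π w , a ⟩) xor ⟨ π v , a ⟩) xor_) ⟨a,a⟩≡e)

module Counting where

  open F₂LinearAlgebra using (xor-cancelʳ)
  open import Level using (Level)
  open import Function using (_∘_)
  open import Data.Bool using (Bool; true; false; _xor_)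
  open import Data.Bool.Properties using (∧-idem)
  open import Data.Nat using (zero; suc; _*_; _^_)
  open import Data.Fin using (Fin; zero; suc; combine; remQuot)
  open import Data.Fin.Properties using (remQuot-combine; combine-remQuot; suc-injective; 0≢1+n)
  open import Data.Vec using (Vec; []; _∷_; tabulate; lookup; allFin)
  open import Data.Vec.Properties using (lookup∘tabulate; lookup-allFin; ∷-injective; ∷-injectiveʳ)
  import Data.Vec.Functional as Fun
  import Data.Vec.Functional.Relation.Binary.Pointwise as Functional
  open import Data.Product using (∃; _×_; _,_; proj₁; proj₂; uncurry)
  open import Data.Product.Relation.Binary.Pointwise.NonDependent using (Pointwise)
  open import Data.Empty using (⊥; ⊥-elim)
  open import Data.Unit using (tt)
  open import Relation.Nullary using (yes; no)
  open import Relation.Unary using (Pred; U; Decidable)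
  open import Relation.Binary using (Rel; Reflexive; Transitive; _Respects_; IsEquivalence)
  open import Relation.Binary.PropositionalEquality

  private
    variable
      a b p p′ r s : Level
      A B : Set a

  HasCard-map : ∀ {_≈A_ : Rel A r} {_≈B_ : Rel B s} {P : Pred A p} {Q : Pred B p′} {N} →
    Transitive _≈B_ → (F : A → B) →
    (∀ {x} → P x → Q (F x)) →
    (∀ {x y} → P x → P y → F x ≈B F y → x ≈A y) →
    (∀ {x y} → x ≈A y → F x ≈B F y) →
    (∀ {z} → Q z → ∃ λ x → P x × z ≈B F x) →
    HasCard _≈A_ P N → HasCard _≈B_ Q N
  HasCard-map {_≈B_ = _≈B_} {Q = Q} ≈B-trans F F-pres F-refl F-cong F-onto (v , v∈P , v-distinct , v-covers) =
    tabulate (F ∘ lookup v) ,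
    (λ i → subst Q (sym (lookup∘tabulate _ i)) (F-pres (v∈P i))) ,
    (λ i j Fvi≈Fvj → v-distinct i j (F-refl (v∈P i) (v∈P j)
      (subst₂ _≈B_ (lookup∘tabulate _ i) (lookup∘tabulate _ j) Fvi≈Fvj))) ,
    λ z z∈Q → let (x , x∈P , z≈Fx) = F-onto z∈Q ; (i , x≈vi) = v-covers x x∈P in
      i , subst (z ≈B_) (sym (lookup∘tabulate _ i)) (≈B-trans z≈Fx (F-cong x≈vi))

  HasCard-⇔ : ∀ {_≈_ : Rel A r} {P : Pred A p} {Q : Pred A p′} {N} →
    (∀ {x} → P x → Q x) → (∀ {x} → Q x → P x) → HasCard _≈_ P N → HasCard _≈_ Q N
  HasCard-⇔ P⇒Q Q⇒P (v , v∈P , v-distinct , v-covers) =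
    v , (λ i → P⇒Q (v∈P i)) , v-distinct , λ x x∈Q → v-covers x (Q⇒P x∈Q)

  HasCard-× : ∀ {_≈A_ : Rel A r} {_≈B_ : Rel B s} {P : Pred A p} {Q : Pred B p′} {N M} →
    HasCard _≈A_ P N → HasCard _≈B_ Q M →
    HasCard (Pointwise _≈A_ _≈B_) (λ z → P (proj₁ z) × Q (proj₂ z)) (N * M)
  HasCard-× {A = A} {B = B} {_≈A_ = _≈A_} {_≈B_} {P} {Q} {N} {M}
    (v , v∈P , v-distinct , v-covers) (w , w∈Q , w-distinct , w-covers) =
    tabulate pair ,
    (λ k → subst (λ z → P (proj₁ z) × Q (proj₂ z)) (sym (lookup∘tabulate pair k)) (v∈P _ , w∈Q _)) ,
    (λ k k′ eq → distinct k k′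
      (subst₂ (Pointwise _≈A_ _≈B_) (lookup∘tabulate pair k) (lookup∘tabulate pair k′) eq)) ,
    λ (x , y) (x∈P , y∈Q) → let (i , x≈vi) = v-covers x x∈P ; (j , y≈wj) = w-covers y y∈Q in
      combine i j , subst (Pointwise _≈A_ _≈B_ (x , y))
        (sym (trans (lookup∘tabulate pair (combine i j))
                    (cong (λ (i , j) → lookup v i , lookup w j) (remQuot-combine i j))))
        (x≈vi , y≈wj)
    where
    pair : Fin (N * M) → A × B
    pair k = let (i , j) = remQuot {N} M k in lookup v i , lookup w j
    distinct : ∀ k k′ → Pointwise _≈A_ _≈B_ (pair k) (pair k′) → k ≡ k′
    distinct k k′ (vi≈vi′ , wj≈wj′) = begin
      k                                 ≡⟨ combine-remQuot {N} M k ⟨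
      uncurry combine (remQuot {N} M k)  ≡⟨ cong₂ combine (v-distinct _ _ vi≈vi′) (w-distinct _ _ wj≈wj′) ⟩
      uncurry combine (remQuot {N} M k′) ≡⟨ combine-remQuot {N} M k′ ⟩
      k′                                ∎
      where open ≡-Reasoning

  HasCard-Fin : ∀ n → HasCard {A = Fin n} _≡_ U n
  HasCard-Fin n = allFin n , (λ _ → tt) ,
    (λ i j eq → trans (sym (lookup-allFin i)) (trans eq (lookup-allFin j))) ,
    λ i _ → i , sym (lookup-allFin i)

  HasCard-Bool : HasCard {A = Bool} _≡_ U 2
  HasCard-Bool = false ∷ true ∷ [] , (λ _ → tt) , distinct , covers
    where
    distinct : ∀ i j → lookup (false ∷ true ∷ []) i ≡ lookup (false ∷ true ∷ []) j → i ≡ j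
    distinct zero       zero       _ = refl
    distinct zero       (suc zero) ()
    distinct (suc zero) zero       ()
    distinct (suc zero) (suc zero) _ = refl
    covers : ∀ b → U b → ∃ λ i → b ≡ lookup (false ∷ true ∷ []) i
    covers false _ = zero , refl
    covers true  _ = suc zero , refl

  HasCard-F2 : ∀ k → HasCard {A = F2 k} _≡_ U (2 ^ k)
  HasCard-F2 zero    = [] ∷ [] , (λ _ → tt) , (λ { zero zero _ → refl }) , λ { [] _ → zero , refl }
  HasCard-F2 (suc k) = HasCard-map trans (uncurry _∷_) _
    (λ _ _ eq → ∷-injective eq)
    (λ (b≡b′ , v≡v′) → cong₂ _∷_ b≡b′ v≡v′)
    (λ { {b ∷ v} _ → (b , v) , _ , refl })
    (HasCard-× {_≈A_ = _≡_} {_≈B_ = _≡_} HasCard-Bool (HasCard-F2 k))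

  HasCard-⟨⟩-diagonal : ∀ k e → HasCard {A = F2 (suc k)} _≡_ (λ a → ⟨ a , a ⟩ ≡ e) (2 ^ k)
  HasCard-⟨⟩-diagonal k e = HasCard-map trans (λ v → (e xor ⟨ v , v ⟩) ∷ v)
    (λ {v} _ → trans (cong (_xor ⟨ v , v ⟩) (∧-idem (e xor ⟨ v , v ⟩))) (xor-cancelʳ e ⟨ v , v ⟩))
    (λ _ _ eq → ∷-injectiveʳ eq)
    (cong (λ v → (e xor ⟨ v , v ⟩) ∷ v))
    (λ { {b ∷ v} aa≡e → v , _ , cong (_∷ v) (trans (sym (xor-cancelʳ b ⟨ v , v ⟩))
         (cong (_xor ⟨ v , v ⟩) (trans (cong (_xor ⟨ v , v ⟩) (sym (∧-idem b))) aa≡e))) })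
    (HasCard-F2 k)

  HasCard-→ : ∀ {_≈_ : Rel B s} {K} → Reflexive _≈_ → Transitive _≈_ →
    HasCard _≈_ U K → ∀ m → HasCard (Functional.Pointwise _≈_ {m}) U (K ^ m)
  HasCard-→ ≈-refl ≈-trans card zero =
    (λ ()) ∷ [] , (λ _ → tt) , (λ { zero zero _ → refl }) , λ _ _ → zero , λ ()
  HasCard-→ {_≈_ = _≈_} ≈-refl ≈-trans card (suc m) =
    HasCard-map (λ f≈g g≈h i → ≈-trans (f≈g i) (g≈h i)) (uncurry Fun._∷_) _
    (λ _ _ f≈g → f≈g zero , f≈g ∘ suc)
    (λ { (x≈y , f≈g) zero → x≈y ; (x≈y , f≈g) (suc i) → f≈g i })
    (λ {f} _ → (f zero , f ∘ suc) , _ , λ { zero → ≈-refl ; (suc i) → ≈-refl })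
    (HasCard-× {_≈A_ = _≈_} {_≈B_ = Functional.Pointwise _≈_} card (HasCard-→ ≈-refl ≈-trans card m))

  module _ {_≈_ : Rel A r} {P : Pred A p} (≈-isEquivalence : IsEquivalence _≈_)
           (P? : Decidable P) (P-resp : P Respects _≈_) where

    private
      open IsEquivalence ≈-isEquivalence renaming (refl to ≈-refl; sym to ≈-sym; trans to ≈-trans)

      Listed : ∀ {K} → Vec A K → Pred A r
      Listed v x = ∃ λ k → x ≈ lookup v k

    HasCard-filter-listed : ∀ {K} (v : Vec A K) → (∀ i j → lookup v i ≈ lookup v j → i ≡ j) →
      ∃ λ N → HasCard _≈_ (λ x → P x × Listed v x) N
    HasCard-filter-listed [] _ = 0 , [] , (λ ()) , (λ ()) , λ { _ (_ , () , _) }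
    HasCard-filter-listed (y ∷ v) y∷v-distinct
      with HasCard-filter-listed v (λ i j eq → suc-injective (y∷v-distinct (suc i) (suc j) eq)) | P? y
    ... | N , w , w∈ , w-distinct , w-covers | no ¬Py =
      N , w , (λ i → let (Pwi , k , wi≈vk) = w∈ i in Pwi , suc k , wi≈vk) , w-distinct , covers
      where
      covers : ∀ x → P x × Listed (y ∷ v) x → ∃ λ i → x ≈ lookup w i
      covers x (Px , zero  , x≈y)  = ⊥-elim (¬Py (P-resp x≈y Px))
      covers x (Px , suc k , x≈vk) = w-covers x (Px , k , x≈vk)
    ... | N , w , w∈ , w-distinct , w-covers | yes Py =
      suc N , y ∷ w , y∷w∈ , y∷w-distinct , covers
      where
      y∷w∈ : ∀ i → P (lookup (y ∷ w) i) × Listed (y ∷ v) (lookup (y ∷ w) i)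
      y∷w∈ zero    = Py , zero , ≈-refl
      y∷w∈ (suc i) = let (Pwi , k , wi≈vk) = w∈ i in Pwi , suc k , wi≈vk
      y≉w : ∀ i → y ≈ lookup w i → ⊥
      y≉w i y≈wi = let (_ , k , wi≈vk) = w∈ i in 0≢1+n (y∷v-distinct zero (suc k) (≈-trans y≈wi wi≈vk))
      y∷w-distinct : ∀ i j → lookup (y ∷ w) i ≈ lookup (y ∷ w) j → i ≡ j
      y∷w-distinct zero    zero    _     = refl
      y∷w-distinct zero    (suc j) y≈wj  = ⊥-elim (y≉w j y≈wj)
      y∷w-distinct (suc i) zero    wi≈y  = ⊥-elim (y≉w i (≈-sym wi≈y))
      y∷w-distinct (suc i) (suc j) wi≈wj = cong suc (w-distinct i j wi≈wj)
      covers : ∀ x → P x × Listed (y ∷ v) x → ∃ λ i → x ≈ lookup (y ∷ w) i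
      covers x (Px , zero  , x≈y)  = zero , x≈y
      covers x (Px , suc k , x≈vk) = let (i , x≈wi) = w-covers x (Px , k , x≈vk) in suc i , x≈wi

    HasCard-filter : ∀ {K} → HasCard _≈_ U K → ∃ λ N → HasCard _≈_ P N
    HasCard-filter (v , _ , v-distinct , v-covers) =
      let (N , card) = HasCard-filter-listed v v-distinct in
      N , HasCard-⇔ {_≈_ = _≈_} proj₁ (λ {x} Px → Px , v-covers x _) card

module OrthogonalMatrices where

  open F₂LinearAlgebra
  open Counting
  open import Data.Bool using (_≟_)
  open import Data.Nat using (_^_)
  open import Data.Fin.Properties using (all?)
  open import Data.Vec using (tabulate; lookup)
  open import Data.Vec.Properties using (lookup∘tabulate; tabulate∘lookup; tabulate-cong)
  open import Data.Product using (∃; _×_; _,_; proj₁; proj₂)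
  open import Function using (_⇔_; mk⇔; Equivalence)
  open import Relation.Nullary using (Dec)
  open import Relation.Nullary.Decidable using (_×-dec_)
  open import Relation.Unary using (U)
  open import Relation.Binary using (IsEquivalence; _Respects_)
  open import Relation.Binary.PropositionalEquality
  open ≡-Reasoning

  ≐-sym : ∀ {m} {A B : Mat m} → A ≐ B → B ≐ A
  ≐-sym A≐B i j = sym (A≐B i j)

  ≐-trans : ∀ {m} {A B C : Mat m} → A ≐ B → B ≐ C → A ≐ C
  ≐-trans A≐B B≐C i j = trans (A≐B i j) (B≐C i j)

  ≐-isEquivalence : ∀ {m} → IsEquivalence (_≐_ {m})
  ≐-isEquivalence = record { refl = λ i j → refl ; sym = ≐-sym ; trans = ≐-trans }

  ≐-dec : ∀ {m} (A B : Mat m) → Dec (A ≐ B)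
  ≐-dec A B = all? (λ i → all? (λ j → A i j ≟ B i j))

  ·-cong : ∀ {m} {A A′ B B′ : Mat m} → A ≐ A′ → B ≐ B′ → (A · B) ≐ (A′ · B′)
  ·-cong A≐A′ B≐B′ i j = cong₂ (λ r c → ⟨ r , c ⟩) (tabulate-cong (A≐A′ i)) (tabulate-cong (λ k → B≐B′ k j))

  transpose-cong : ∀ {m} {A B : Mat m} → A ≐ B → transpose A ≐ transpose B
  transpose-cong A≐B i j = A≐B j i

  ·≐I⇒▹-inverse : ∀ {m} {A B : Mat m} → (A · B) ≐ I → ∀ x → A ▹ B ▹ x ≡ x
  ·≐I⇒▹-inverse {A = A} {B} AB≐I x = trans (sym (·-▹ A B x)) (trans (▹-cong AB≐I x) (I-▹ x))

  ▹-inverse⇒·≐I : ∀ {m} {A B : Mat m} → (∀ x → A ▹ B ▹ x ≡ x) → (A · B) ≐ I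
  ▹-inverse⇒·≐I {A = A} {B} AB▹≗id = ≐-from-▹ (λ x → trans (·-▹ A B x) (trans (AB▹≗id x) (sym (I-▹ x))))

  module _ {m} {L : Mat m} (L-orth : IsOrthogonal L) where

    orthogonal-▹-transpose-inverse : ∀ x → L ▹ transpose L ▹ x ≡ x
    orthogonal-▹-transpose-inverse = ·≐I⇒▹-inverse (proj₂ L-orth)

    orthogonal-transpose-▹-inverse : ∀ x → transpose L ▹ L ▹ x ≡ x
    orthogonal-transpose-▹-inverse x = begin
      transpose L ▹ L ▹ x          ≡⟨ ·≐I⇒▹-inverse ML≐I (transpose L ▹ L ▹ x) ⟨
      M ▹ L ▹ transpose L ▹ L ▹ x  ≡⟨ cong (M ▹_) (orthogonal-▹-transpose-inverse (L ▹ x)) ⟩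
      M ▹ L ▹ x                    ≡⟨ ·≐I⇒▹-inverse ML≐I x ⟩
      x                            ∎
      where
      M : Mat m
      M = proj₁ (proj₁ L-orth)
      ML≐I : (M · L) ≐ I
      ML≐I = proj₂ (proj₂ (proj₁ L-orth))

    orthogonal-preserves-⟨⟩ : ∀ x y → ⟨ L ▹ x , L ▹ y ⟩ ≡ ⟨ x , y ⟩
    orthogonal-preserves-⟨⟩ x y =
      trans (transpose-adjoint L x (L ▹ y)) (cong (λ z → ⟨ x , z ⟩) (orthogonal-transpose-▹-inverse y))

  TransposeIsInverse : ∀ {m} → Mat m → Set
  TransposeIsInverse L = (L · transpose L) ≐ I × (transpose L · L) ≐ I

  TransposeIsInverse? : ∀ {m} (L : Mat m) → Dec (TransposeIsInverse L)
  TransposeIsInverse? L = ≐-dec (L · transpose L) I ×-dec ≐-dec (transpose L · L) I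

  TransposeIsInverse-resp : ∀ {m} → TransposeIsInverse {m} Respects _≐_
  TransposeIsInverse-resp L≐L′ (LLᵀ≐I , LᵀL≐I) =
    ≐-trans (·-cong (≐-sym L≐L′) (≐-sym (transpose-cong L≐L′))) LLᵀ≐I ,
    ≐-trans (·-cong (≐-sym (transpose-cong L≐L′)) (≐-sym L≐L′)) LᵀL≐I

  IsOrthogonal⇔TransposeIsInverse : ∀ {m} {L : Mat m} → IsOrthogonal L ⇔ TransposeIsInverse L
  IsOrthogonal⇔TransposeIsInverse {L = L} = mk⇔
    (λ L-orth → proj₂ L-orth , ▹-inverse⇒·≐I (orthogonal-transpose-▹-inverse L-orth))
    (λ (LLᵀ≐I , LᵀL≐I) → (transpose L , LLᵀ≐I , LᵀL≐I) , LLᵀ≐I)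

  HasCard-orthogonal : ∀ m → ∃ λ N → HasCard (_≐_ {m}) IsOrthogonal N
  HasCard-orthogonal m =
    let (N , card) = HasCard-filter ≐-isEquivalence TransposeIsInverse? TransposeIsInverse-resp all-matrices in
    N , HasCard-⇔ {_≈_ = _≐_}
          (Equivalence.from IsOrthogonal⇔TransposeIsInverse) (Equivalence.to IsOrthogonal⇔TransposeIsInverse) card
    where
    all-matrices : HasCard (_≐_ {m}) U ((2 ^ m) ^ m)
    all-matrices =
      HasCard-→ (λ i → refl) (λ f≗g g≗h i → trans (f≗g i) (g≗h i)) (HasCard-→ refl trans HasCard-Bool m) m

  matrixOf : ∀ {m} → (F2 m → F2 m) → Mat m
  matrixOf f i j = lookup (f (basis j)) i

  module _ {m} (f g : F2 m → F2 m) (f∘g≗id : ∀ x → f (g x) ≡ x)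
           (f-isometry : ∀ x y → ⟨ f x , f y ⟩ ≡ ⟨ x , y ⟩) where

    ⟨f,⟩≡⟨,g⟩ : ∀ x y → ⟨ f x , y ⟩ ≡ ⟨ x , g y ⟩
    ⟨f,⟩≡⟨,g⟩ x y = trans (cong (λ z → ⟨ f x , z ⟩) (sym (f∘g≗id y))) (f-isometry x (g y))

    isometry-matrixOf-▹ : ∀ x → matrixOf f ▹ x ≡ f x
    isometry-matrixOf-▹ x = lookup-ext λ i → begin
      lookup (matrixOf f ▹ x) i     ≡⟨ lookup∘tabulate _ i ⟩
      ⟨ tabulate (matrixOf f i) , x ⟩ ≡⟨ cong (λ r → ⟨ r , x ⟩) (row i) ⟩
      ⟨ g (basis i) , x ⟩           ≡⟨ ⟨⟩-comm (g (basis i)) x ⟩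
      ⟨ x , g (basis i) ⟩           ≡⟨ ⟨f,⟩≡⟨,g⟩ x (basis i) ⟨
      ⟨ f x , basis i ⟩             ≡⟨ ⟨⟩-comm (f x) (basis i) ⟩
      ⟨ basis i , f x ⟩             ≡⟨ ⟨basis,x⟩≡lookup i (f x) ⟩
      lookup (f x) i                ∎
      where
      row : ∀ i → tabulate (matrixOf f i) ≡ g (basis i)
      row i = lookup-ext λ j → begin
        lookup (tabulate (matrixOf f i)) j ≡⟨ lookup∘tabulate (matrixOf f i) j ⟩
        lookup (f (basis j)) i             ≡⟨ ⟨basis,x⟩≡lookup i (f (basis j)) ⟨
        ⟨ basis i , f (basis j) ⟩          ≡⟨ ⟨⟩-comm (basis i) (f (basis j)) ⟩
        ⟨ f (basis j) , basis i ⟩          ≡⟨ ⟨f,⟩≡⟨,g⟩ (basis j) (basis i) ⟩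
        ⟨ basis j , g (basis i) ⟩          ≡⟨ ⟨basis,x⟩≡lookup j (g (basis i)) ⟩
        lookup (g (basis i)) j             ∎

    isometry-transpose-matrixOf-▹ : ∀ x → transpose (matrixOf f) ▹ x ≡ g x
    isometry-transpose-matrixOf-▹ x = lookup-ext λ i → begin
      lookup (transpose (matrixOf f) ▹ x) i ≡⟨ lookup∘tabulate _ i ⟩
      ⟨ tabulate (lookup (f (basis i))) , x ⟩ ≡⟨ cong (λ r → ⟨ r , x ⟩) (tabulate∘lookup (f (basis i))) ⟩
      ⟨ f (basis i) , x ⟩                 ≡⟨ ⟨f,⟩≡⟨,g⟩ (basis i) x ⟩
      ⟨ basis i , g x ⟩                   ≡⟨ ⟨basis,x⟩≡lookup i (g x) ⟩
      lookup (g x) i                      ∎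

    isometry⇒orthogonal : (∀ x → g (f x) ≡ x) → IsOrthogonal (matrixOf f)
    isometry⇒orthogonal g∘f≗id = Equivalence.from IsOrthogonal⇔TransposeIsInverse
      ( ▹-inverse⇒·≐I (λ x → trans (cong (matrixOf f ▹_) (isometry-transpose-matrixOf-▹ x))
                                   (trans (isometry-matrixOf-▹ (g x)) (f∘g≗id x)))
      , ▹-inverse⇒·≐I (λ x → trans (cong (transpose (matrixOf f) ▹_) (isometry-matrixOf-▹ x))
                                   (trans (isometry-transpose-matrixOf-▹ (f x)) (g∘f≗id x))))

module CharacterSums {c ℓ} (R : CommutativeRing c ℓ) where
  open import Data.Bool using (Bool; true; false; _xor_; if_then_else_) renaming (_≟_ to _≟ᵇ_)
  open import Data.Bool.Properties using (xor-same)
  open import Data.Nat using (ℕ; zero; suc; _^_)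
  import Data.Nat as ℕ
  import Data.Nat.Properties as ℕ
  open import Data.Fin using (toℕ)
  open import Data.List using (List; []; _∷_; _++_; map)
  open import Data.Vec using ([]; _∷_)
  open import Data.Vec.Properties using (≡-dec)
  open import Function using (mk⇔)
  open import Relation.Nullary using (Dec; does)
  open import Relation.Nullary.Decidable using (does-⇔)
  open import Relation.Binary.PropositionalEquality as ≡ using (_≡_)
  open CommutativeRing R
  open WithRing R
  open import Algebra.Properties.Ring ring using (-1*x≈-x; -‿involutive)
  open import Algebra.Properties.CommutativeSemigroup *-commutativeSemigroup using (interchange)
  open import Algebra.Properties.CommutativeSemigroup +-commutativeSemigroup
    using () renaming (interchange to +-interchange)
  open import Relation.Binary.Reasoning.Setoid setoid

  _≟ᵥ_ : ∀ {m} (x y : F2 m) → Dec (x ≡ y)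
  _≟ᵥ_ = ≡-dec _≟ᵇ_

  sumR-cong : ∀ {A : Set} (xs : List A) {f g : A → Carrier} → (∀ a → f a ≈ g a) → sumR xs f ≈ sumR xs g
  sumR-cong []       f≈g = refl
  sumR-cong (x ∷ xs) f≈g = +-cong (f≈g x) (sumR-cong xs f≈g)

  sumR-++ : ∀ {A : Set} (xs ys : List A) (f : A → Carrier) → sumR (xs ++ ys) f ≈ sumR xs f + sumR ys f
  sumR-++ []       ys f = sym (+-identityˡ _)
  sumR-++ (x ∷ xs) ys f = trans (+-cong refl (sumR-++ xs ys f)) (sym (+-assoc _ _ _))

  sumR-map : ∀ {A B : Set} (g : A → B) (xs : List A) (f : B → Carrier) →
    sumR (map g xs) f ≡ sumR xs (λ a → f (g a))
  sumR-map g []       f = ≡.refl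
  sumR-map g (x ∷ xs) f = ≡.cong (f (g x) +_) (sumR-map g xs f)

  sumR-zero : ∀ {A : Set} (xs : List A) → sumR xs (λ _ → 0#) ≈ 0#
  sumR-zero []       = refl
  sumR-zero (x ∷ xs) = trans (+-identityˡ _) (sumR-zero xs)

  sumR-+ : ∀ {A : Set} (xs : List A) (f g : A → Carrier) → sumR xs (λ a → f a + g a) ≈ sumR xs f + sumR xs g
  sumR-+ []       f g = sym (+-identityˡ 0#)
  sumR-+ (x ∷ xs) f g = trans (+-cong refl (sumR-+ xs f g)) (+-interchange (f x) (g x) (sumR xs f) (sumR xs g))

  sumR-*ˡ : ∀ {A : Set} (xs : List A) (k : Carrier) (f : A → Carrier) → sumR xs (λ a → k * f a) ≈ k * sumR xs f
  sumR-*ˡ []       k f = sym (zeroʳ k)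
  sumR-*ˡ (x ∷ xs) k f = trans (+-cong refl (sumR-*ˡ xs k f)) (sym (distribˡ k (f x) _))

  sumR-*ʳ : ∀ {A : Set} (xs : List A) (f : A → Carrier) (k : Carrier) → sumR xs (λ a → f a * k) ≈ sumR xs f * k
  sumR-*ʳ []       f k = sym (zeroˡ k)
  sumR-*ʳ (x ∷ xs) f k = trans (+-cong refl (sumR-*ʳ xs f k)) (sym (distribʳ k (f x) _))

  sumR-comm : ∀ {A B : Set} (xs : List A) (ys : List B) (f : A → B → Carrier) →
    sumR xs (λ a → sumR ys (f a)) ≈ sumR ys (λ b → sumR xs (λ a → f a b))
  sumR-comm []       ys f = sym (sumR-zero ys)
  sumR-comm (x ∷ xs) ys f = trans (+-cong refl (sumR-comm xs ys f)) (sym (sumR-+ ys (f x) _))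

  sumR-allF2-suc : ∀ m (f : F2 (suc m) → Carrier) →
    sumR (allF2 (suc m)) f ≈ sumR (allF2 m) (λ x → f (false ∷ x)) + sumR (allF2 m) (λ x → f (true ∷ x))
  sumR-allF2-suc m f = trans (sumR-++ (map (false ∷_) (allF2 m)) _ f)
    (+-cong (reflexive (sumR-map _ (allF2 m) f)) (reflexive (sumR-map _ (allF2 m) f)))

  natR-+ : ∀ a b → natR (a ℕ.+ b) ≈ natR a + natR b
  natR-+ zero    b = sym (+-identityˡ _)
  natR-+ (suc a) b = trans (+-cong refl (natR-+ a b)) (sym (+-assoc _ _ _))

  natR-2^suc : ∀ m → natR (2 ^ suc m) ≈ natR (2 ^ m) + natR (2 ^ m)
  natR-2^suc m = trans (natR-+ (2 ^ m) (2 ^ m ℕ.+ 0)) (+-cong refl (reflexive (≡.cong natR (ℕ.+-identityʳ (2 ^ m)))))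

  sgn-xor : ∀ a b → sgn (a xor b) ≈ sgn a * sgn b
  sgn-xor false b     = sym (*-identityˡ _)
  sgn-xor true  false = sym (*-identityʳ _)
  sgn-xor true  true  = sym (trans (-1*x≈-x (- 1#)) (-‿involutive 1#))

  sgn-square : ∀ b → sgn b * sgn b ≈ 1#
  sgn-square b = trans (sym (sgn-xor b b)) (reflexive (≡.cong sgn (xor-same b)))

  pow-+ : ∀ w a b → pow w (a ℕ.+ b) ≈ pow w a * pow w b
  pow-+ w zero    b = sym (*-identityˡ _)
  pow-+ w (suc a) b = trans (*-cong refl (pow-+ w a b)) (sym (*-assoc _ _ _))

  if-*ʳ : ∀ b (x k : Carrier) → (if b then x else 0#) * k ≈ (if b then x * k else 0#)
  if-*ʳ true  x k = refl
  if-*ʳ false x k = zeroˡ k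

  sgn-orthogonality : ∀ m (y u : F2 m) →
    sumR (allF2 m) (λ x → sgn ⟨ x , y ⟩ * sgn ⟨ x , u ⟩) ≈ (if does (y ≟ᵥ u) then natR (2 ^ m) else 0#)
  sgn-orthogonality zero    []      []        = +-cong (*-identityˡ 1#) refl
  sgn-orthogonality (suc m) (b ∷ y) (b′ ∷ u) = begin
    sumR (allF2 (suc m)) (λ x → sgn ⟨ x , b ∷ y ⟩ * sgn ⟨ x , b′ ∷ u ⟩)
      ≈⟨ sumR-allF2-suc m _ ⟩
    S + sumR (allF2 m) (λ x → sgn (b xor ⟨ x , y ⟩) * sgn (b′ xor ⟨ x , u ⟩))
      ≈⟨ +-cong refl (sumR-cong (allF2 m) (λ x →
           trans (*-cong (sgn-xor b _) (sgn-xor b′ _)) (interchange _ _ _ _))) ⟩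
    S + sumR (allF2 m) (λ x → (sgn b * sgn b′) * (sgn ⟨ x , y ⟩ * sgn ⟨ x , u ⟩))
      ≈⟨ +-cong refl (sumR-*ˡ (allF2 m) (sgn b * sgn b′) _) ⟩
    S + (sgn b * sgn b′) * S
      ≈⟨ combine b b′ ⟩
    (if does ((b ∷ y) ≟ᵥ (b′ ∷ u)) then natR (2 ^ suc m) else 0#) ∎
    where
    S : Carrier
    S = sumR (allF2 m) (λ x → sgn ⟨ x , y ⟩ * sgn ⟨ x , u ⟩)
    double : ∀ d → S ≈ (if d then natR (2 ^ m) else 0#) → S + S ≈ (if d then natR (2 ^ suc m) else 0#)
    double true  S≈ = trans (+-cong S≈ S≈) (sym (natR-2^suc m))
    double false S≈ = trans (+-cong S≈ S≈) (+-identityʳ 0#)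
    same : ∀ b → S + (sgn b * sgn b) * S ≈ (if does (y ≟ᵥ u) then natR (2 ^ suc m) else 0#)
    same b = trans (+-cong refl (trans (*-cong (sgn-square b) refl) (*-identityˡ S)))
                   (double (does (y ≟ᵥ u)) (sgn-orthogonality m y u))
    opposite : ∀ {s} → s ≈ - 1# → S + s * S ≈ 0#
    opposite s≈-1 = trans (+-cong refl (trans (*-cong s≈-1 refl) (-1*x≈-x S))) (-‿inverseʳ S)
    combine : ∀ b b′ → S + (sgn b * sgn b′) * S ≈ (if does ((b ∷ y) ≟ᵥ (b′ ∷ u)) then natR (2 ^ suc m) else 0#)
    combine false false = same false
    combine true  true  = same true
    combine false true  = opposite (*-identityˡ (- 1#))
    combine true  false = opposite (*-identityʳ (- 1#))

  sumR-select : ∀ m (y₀ : F2 m) (F : F2 m → Carrier) →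
    sumR (allF2 m) (λ y → if does (y ≟ᵥ y₀) then F y else 0#) ≈ F y₀
  sumR-select zero    []           F = +-identityʳ (F [])
  sumR-select (suc m) (false ∷ y₀) F = trans (sumR-allF2-suc m _)
    (trans (+-cong (sumR-select m y₀ (λ y → F (false ∷ y))) (sumR-zero (allF2 m))) (+-identityʳ _))
  sumR-select (suc m) (true ∷ y₀)  F = trans (sumR-allF2-suc m _)
    (trans (+-cong (sumR-zero (allF2 m)) (sumR-select m y₀ (λ y → F (true ∷ y)))) (+-identityˡ _))

  MMForm : ∀ {m q} → Carrier → Fun2 m q → (F2 m → F2 m) → (F2 m → Carrier) → Set ℓ
  MMForm ω f π G = ∀ x y → pow ω (toℕ (f x y)) ≈ sgn ⟨ x , π y ⟩ * G y

  walsh-MM : ∀ {m q} {ω : Carrier} {f : Fun2 m q} {π : F2 m → F2 m} {G : F2 m → Carrier} →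
    MMForm ω f π G → (∀ {y y′} → π y ≡ π y′ → y ≡ y′) →
    ∀ w v → H ω f (π w) v ≈ natR (2 ^ m) * (G w * sgn ⟨ w , v ⟩)
  walsh-MM {m} {ω = ω} {f} {π} {G} f-MM π-injective w v = begin
    H ω f (π w) v
      ≈⟨ sumR-cong A (λ x → sumR-cong A (λ y → term x y)) ⟩
    sumR A (λ x → sumR A (λ y → (sgn ⟨ x , π y ⟩ * sgn ⟨ x , π w ⟩) * K y))
      ≈⟨ sumR-comm A A _ ⟩
    sumR A (λ y → sumR A (λ x → (sgn ⟨ x , π y ⟩ * sgn ⟨ x , π w ⟩) * K y))
      ≈⟨ sumR-cong A (λ y → sumR-*ʳ A _ (K y)) ⟩
    sumR A (λ y → sumR A (λ x → sgn ⟨ x , π y ⟩ * sgn ⟨ x , π w ⟩) * K y)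
      ≈⟨ sumR-cong A (λ y → *-cong (sgn-orthogonality m (π y) (π w)) refl) ⟩
    sumR A (λ y → (if does (π y ≟ᵥ π w) then natR (2 ^ m) else 0#) * K y)
      ≈⟨ sumR-cong A (λ y → trans (if-*ʳ _ (natR (2 ^ m)) (K y))
           (reflexive (≡.cong (λ d → if d then natR (2 ^ m) * K y else 0#)
             (does-⇔ (mk⇔ π-injective (≡.cong π)) (π y ≟ᵥ π w) (y ≟ᵥ w))))) ⟩
    sumR A (λ y → if does (y ≟ᵥ w) then natR (2 ^ m) * K y else 0#)
      ≈⟨ sumR-select m w (λ y → natR (2 ^ m) * K y) ⟩
    natR (2 ^ m) * K w ∎
    where
    A : List (F2 m)
    A = allF2 m
    K : F2 m → Carrier
    K y = G y * sgn ⟨ y , v ⟩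
    term : ∀ x y →
      pow ω (toℕ (f x y)) * sgn (⟨ x , π w ⟩ xor ⟨ y , v ⟩) ≈ (sgn ⟨ x , π y ⟩ * sgn ⟨ x , π w ⟩) * K y
    term x y = trans (*-cong (f-MM x y) (sgn-xor ⟨ x , π w ⟩ ⟨ y , v ⟩)) (interchange _ _ _ _)

module IntegralDomain {c ℓ} (R : CommutativeRing c ℓ) (domain : WithRing.IsCharZeroDomain R) where
  open F₂LinearAlgebra using (0ᵥ; ⟨⟩-zeroˡ; ⟨⟩-nondegenerate)
  open import Data.Bool using (true; false)
  open import Data.Nat using (suc)
  open import Data.Product using (_×_; _,_; proj₁; proj₂)
  open import Data.Sum using ([_,_])
  open import Data.Empty using (⊥-elim)
  open import Relation.Nullary using (¬_)
  open import Relation.Binary.PropositionalEquality as ≡ using (_≡_)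
  open CommutativeRing R
  open WithRing R
  open CharacterSums R using (sgn-square)
  open import Algebra.Properties.Ring ring using (x[y-z]≈xy-xz; x∙y⁻¹≈ε⇒x≈y)
  open import Relation.Binary.Reasoning.Setoid setoid

  1≉0 : ¬ 1# ≈ 0#
  1≉0 1≈0 = proj₁ domain 0 (trans (+-identityʳ 1#) 1≈0)

  1≉-1 : ¬ 1# ≈ - 1#
  1≉-1 1≈-1 = proj₁ domain 1 (trans (+-cong refl (+-identityʳ 1#)) (trans (+-cong 1≈-1 refl) (-‿inverseˡ 1#)))

  natR≉0 : ∀ n .{{_ : NonZero n}} → ¬ natR n ≈ 0#
  natR≉0 (suc n) = proj₁ domain n

  *-≉0 : ∀ {a b} → ¬ a ≈ 0# → ¬ b ≈ 0# → ¬ a * b ≈ 0#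
  *-≉0 a≉0 b≉0 ab≈0 = [ a≉0 , b≉0 ] (proj₂ domain _ _ ab≈0)

  *-cancelˡ : ∀ {a x y} → ¬ a ≈ 0# → a * x ≈ a * y → x ≈ y
  *-cancelˡ {a} {x} {y} a≉0 ax≈ay = [ (λ a≈0 → ⊥-elim (a≉0 a≈0)) , x∙y⁻¹≈ε⇒x≈y x y ]
    (proj₂ domain a (x - y) (trans (x[y-z]≈xy-xz a x y) (trans (+-cong ax≈ay refl) (-‿inverseʳ (a * y)))))

  *-cancelʳ : ∀ {a x y} → ¬ a ≈ 0# → x * a ≈ y * a → x ≈ y
  *-cancelʳ a≉0 xa≈ya = *-cancelˡ a≉0 (trans (*-comm _ _) (trans xa≈ya (*-comm _ _)))

  pow≉0 : ∀ {w} → ¬ w ≈ 0# → ∀ k → ¬ pow w k ≈ 0#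
  pow≉0 w≉0 0       = 1≉0
  pow≉0 w≉0 (suc k) = *-≉0 w≉0 (pow≉0 w≉0 k)

  sgn≉0 : ∀ b → ¬ sgn b ≈ 0#
  sgn≉0 b sb≈0 = 1≉0 (trans (sym (sgn-square b)) (trans (*-cong sb≈0 refl) (zeroˡ (sgn b))))

  sgn-injective : ∀ {a b} → sgn a ≈ sgn b → a ≡ b
  sgn-injective {false} {false} _     = ≡.refl
  sgn-injective {true}  {true}  _     = ≡.refl
  sgn-injective {false} {true}  1≈-1 = ⊥-elim (1≉-1 1≈-1)
  sgn-injective {true}  {false} -1≈1 = ⊥-elim (1≉-1 (sym -1≈1))

  sgn-MM-injective : ∀ {m} {π π′ : F2 m → F2 m} {G G′ : F2 m → Carrier} → (∀ y → ¬ G y ≈ 0#) →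
    (∀ x y → sgn ⟨ x , π y ⟩ * G y ≈ sgn ⟨ x , π′ y ⟩ * G′ y) → ∀ y → π y ≡ π′ y × G y ≈ G′ y
  sgn-MM-injective {π = π} {π′} {G} {G′} G≉0 MM≈MM′ y = π≡π′ , G≈G′
    where
    G≈G′ : G y ≈ G′ y
    G≈G′ = begin
      G y                        ≈⟨ *-identityˡ (G y) ⟨
      1# * G y                   ≈⟨ *-cong (reflexive (≡.cong sgn (⟨⟩-zeroˡ (π y)))) refl ⟨
      sgn ⟨ 0ᵥ , π y ⟩ * G y     ≈⟨ MM≈MM′ 0ᵥ y ⟩
      sgn ⟨ 0ᵥ , π′ y ⟩ * G′ y   ≈⟨ *-cong (reflexive (≡.cong sgn (⟨⟩-zeroˡ (π′ y)))) refl ⟩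
      1# * G′ y                  ≈⟨ *-identityˡ (G′ y) ⟩
      G′ y                       ∎
    π≡π′ : π y ≡ π′ y
    π≡π′ = ⟨⟩-nondegenerate (λ x →
      sgn-injective (*-cancelʳ (G≉0 y) (trans (MM≈MM′ x y) (*-cong refl (sym G≈G′)))))

module SignedDuality {c ℓ} (R : CommutativeRing c ℓ) (domain : WithRing.IsCharZeroDomain R) where
  open F₂LinearAlgebra using (0ᵥ; ⟨⟩-zeroʳ; SignCondition)
  open import Data.Bool using (Bool; _xor_)
  open import Data.Nat using (_^_)
  open import Data.Nat.Properties using (m^n≢0)
  open import Data.Fin using (toℕ)
  open import Data.Product using (_,_)
  open import Function using (_⇔_; mk⇔; Bijective)
  open import Relation.Nullary using (¬_)
  open import Relation.Binary.PropositionalEquality as ≡ using (_≡_)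
  open CommutativeRing R
  open WithRing R
  open CharacterSums R using (sgn-xor; MMForm; walsh-MM)
  open IntegralDomain R domain
  open import Algebra.Properties.CommutativeSemigroup *-commutativeSemigroup using (xy∙z≈y∙xz; x∙yz≈z∙xy)
  open import Relation.Binary.Reasoning.Setoid setoid

  IsSignedDual : ∀ {m q} → Carrier → Bool → Fun2 m q → Set ℓ
  IsSignedDual {m} ω e f = ∀ u v → H ω f u v ≈ natR (2 ^ m) * (pow ω (toℕ (f u v)) * sgn e)

  DualityCondition : ∀ {m} → Bool → (F2 m → F2 m) → (F2 m → Carrier) → Set ℓ
  DualityCondition e π G = ∀ w v → G w * sgn ⟨ w , v ⟩ ≈ (sgn ⟨ π w , π v ⟩ * G v) * sgn e

  IsSignedDual⇔DualityCondition : ∀ {m q} {ω} {f : Fun2 m q} {π : F2 m → F2 m} {G} e →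
    MMForm ω f π G → Bijective _≡_ _≡_ π → IsSignedDual ω e f ⇔ DualityCondition e π G
  IsSignedDual⇔DualityCondition {m} {ω = ω} {f} {π} {G} e f-MM (π-injective , π-surjective) = mk⇔
    (λ f-dual w v → *-cancelˡ 2^m≉0 (begin
      natR (2 ^ m) * (G w * sgn ⟨ w , v ⟩)                        ≈⟨ walsh-MM {ω = ω} {f} f-MM π-injective w v ⟨
      H ω f (π w) v                                                ≈⟨ f-dual (π w) v ⟩
      natR (2 ^ m) * (pow ω (toℕ (f (π w) v)) * sgn e)             ≈⟨ *-cong refl (*-cong (f-MM (π w) v) refl) ⟩
      natR (2 ^ m) * ((sgn ⟨ π w , π v ⟩ * G v) * sgn e)           ∎))
    (λ condition u v → let (w , πw≡u) = π-surjective u in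
      ≡.subst (λ u → H ω f u v ≈ natR (2 ^ m) * (pow ω (toℕ (f u v)) * sgn e)) (πw≡u ≡.refl) (begin
        H ω f (π w) v                                              ≈⟨ walsh-MM {ω = ω} {f} f-MM π-injective w v ⟩
        natR (2 ^ m) * (G w * sgn ⟨ w , v ⟩)                      ≈⟨ *-cong refl (condition w v) ⟩
        natR (2 ^ m) * ((sgn ⟨ π w , π v ⟩ * G v) * sgn e)         ≈⟨ *-cong refl (*-cong (f-MM (π w) v) refl) ⟨
        natR (2 ^ m) * (pow ω (toℕ (f (π w) v)) * sgn e)           ∎))
    where
    2^m≉0 : ¬ natR (2 ^ m) ≈ 0#
    2^m≉0 = natR≉0 (2 ^ m) {{m^n≢0 2 m}}

  DualityCondition⇒shape : ∀ {m} {e} {π : F2 m → F2 m} {G} → DualityCondition e π G →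
    ∀ w → G w ≈ sgn ⟨ π w , π 0ᵥ ⟩ * (G 0ᵥ * sgn e)
  DualityCondition⇒shape {e = e} {π} {G} condition w = begin
    G w                                    ≈⟨ *-identityʳ (G w) ⟨
    G w * 1#                               ≈⟨ *-cong refl (reflexive (≡.cong sgn (⟨⟩-zeroʳ w))) ⟨
    G w * sgn ⟨ w , 0ᵥ ⟩                   ≈⟨ condition w 0ᵥ ⟩
    (sgn ⟨ π w , π 0ᵥ ⟩ * G 0ᵥ) * sgn e    ≈⟨ *-assoc _ _ _ ⟩
    sgn ⟨ π w , π 0ᵥ ⟩ * (G 0ᵥ * sgn e)    ∎

  DualityCondition⇔SignCondition : ∀ {m} {e} {π : F2 m → F2 m} {G} {a C} → ¬ C ≈ 0# →
    (∀ w → G w ≈ sgn ⟨ π w , a ⟩ * C) → DualityCondition e π G ⇔ SignCondition e π a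
  DualityCondition⇔SignCondition {e = e} {π} {G} {a} {C} C≉0 G-shape = mk⇔
    (λ condition w v → sgn-injective (*-cancelˡ C≉0 (trans (sym (lhs w v)) (trans (condition w v) (rhs w v)))))
    (λ sign-condition w v →
      trans (lhs w v) (trans (*-cong refl (reflexive (≡.cong sgn (sign-condition w v)))) (sym (rhs w v))))
    where
    lhs : ∀ w v → G w * sgn ⟨ w , v ⟩ ≈ C * sgn (⟨ π w , a ⟩ xor ⟨ w , v ⟩)
    lhs w v = begin
      G w * sgn ⟨ w , v ⟩                       ≈⟨ *-cong (G-shape w) refl ⟩
      (sgn ⟨ π w , a ⟩ * C) * sgn ⟨ w , v ⟩     ≈⟨ xy∙z≈y∙xz _ _ _ ⟩
      C * (sgn ⟨ π w , a ⟩ * sgn ⟨ w , v ⟩)     ≈⟨ *-cong refl (sgn-xor _ _) ⟨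
      C * sgn (⟨ π w , a ⟩ xor ⟨ w , v ⟩)       ∎
    rhs : ∀ w v → (sgn ⟨ π w , π v ⟩ * G v) * sgn e ≈ C * sgn ((⟨ π w , π v ⟩ xor ⟨ π v , a ⟩) xor e)
    rhs w v = begin
      (sgn ⟨ π w , π v ⟩ * G v) * sgn e                     ≈⟨ *-cong (*-cong refl (G-shape v)) refl ⟩
      (sgn ⟨ π w , π v ⟩ * (sgn ⟨ π v , a ⟩ * C)) * sgn e   ≈⟨ *-cong (x∙yz≈z∙xy _ _ _) refl ⟩
      (C * (sgn ⟨ π w , π v ⟩ * sgn ⟨ π v , a ⟩)) * sgn e   ≈⟨ *-assoc _ _ _ ⟩
      C * ((sgn ⟨ π w , π v ⟩ * sgn ⟨ π v , a ⟩) * sgn e)   ≈⟨ *-cong refl (*-cong (sgn-xor _ _) refl) ⟨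
      C * (sgn (⟨ π w , π v ⟩ xor ⟨ π v , a ⟩) * sgn e)     ≈⟨ *-cong refl (sgn-xor _ _) ⟨
      C * sgn ((⟨ π w , π v ⟩ xor ⟨ π v , a ⟩) xor e)       ∎

module PrimitiveRoot {c ℓ} (R : CommutativeRing c ℓ) (domain : WithRing.IsCharZeroDomain R)
       (q h : ℕ) .{{_ : NonZero q}} (q≡h+h : q ≡ h ℕ.+ h) (1≤h : 1 ≤ h)
       (ω : CommutativeRing.Carrier R) (ω-primitive : WithRing.IsPrimitiveRoot R q ω) where
  open import Data.Bool using (Bool; true; false)
  open import Data.Nat using (suc; pred; _∸_; _<_; _%_)
  open import Data.Nat.Properties
    using (suc-pred; m+[n∸m]≡n; m<n⇒0<n∸m; m∸n≤m; ≤-<-trans; <⇒≤; <-cmp; m<m+n)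
  import Data.Nat.Properties as ℕ
  open import Data.Nat.DivMod using (_mod_; m≡m%n+[m/n]*n; m%n<n; _/_)
  open import Data.Fin using (Fin; toℕ)
  open import Data.Fin.Properties using (toℕ-fromℕ<; toℕ-injective; toℕ<n)
  open import Function using (_⇔_; mk⇔)
  open import Data.Product using (proj₁; proj₂)
  open import Data.Sum using (inj₁; inj₂)
  open import Data.Empty using (⊥-elim)
  open import Relation.Nullary using (¬_)
  open import Relation.Binary.Definitions using (tri<; tri≈; tri>)
  open import Relation.Binary.PropositionalEquality as ≡ using (_≡_)
  open CommutativeRing R
  open WithRing R
  open CharacterSums R using (pow-+)
  open IntegralDomain R domain
  open SignedDuality R domain using (IsSignedDual)
  open import Algebra.Properties.Ring ring using (x[y-z]≈xy-xz; x∙y⁻¹≈ε⇒x≈y; -‿involutive)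
  open import Relation.Binary.Reasoning.Setoid setoid

  ω≉0 : ¬ ω ≈ 0#
  ω≉0 ω≈0 = 1≉0 (begin
    1#                  ≈⟨ proj₁ ω-primitive ⟨
    pow ω q             ≡⟨ ≡.cong (pow ω) (suc-pred q) ⟨
    ω * pow ω (pred q)  ≈⟨ *-cong ω≈0 refl ⟩
    0# * pow ω (pred q) ≈⟨ zeroˡ _ ⟩
    0#                  ∎)

  pow-*q : ∀ k → pow ω (k ℕ.* q) ≈ 1#
  pow-*q 0       = refl
  pow-*q (suc k) = trans (pow-+ ω q (k ℕ.* q)) (trans (*-cong (proj₁ ω-primitive) (pow-*q k)) (*-identityˡ 1#))

  pow-% : ∀ x → pow ω (x % q) ≈ pow ω x
  pow-% x = sym (begin
    pow ω x                              ≡⟨ ≡.cong (pow ω) (m≡m%n+[m/n]*n x q) ⟩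
    pow ω (x % q ℕ.+ x / q ℕ.* q)        ≈⟨ pow-+ ω (x % q) (x / q ℕ.* q) ⟩
    pow ω (x % q) * pow ω (x / q ℕ.* q)  ≈⟨ *-cong refl (pow-*q (x / q)) ⟩
    pow ω (x % q) * 1#                   ≈⟨ *-identityʳ _ ⟩
    pow ω (x % q)                        ∎)

  pow-mod : ∀ x → pow ω (toℕ (x mod q)) ≈ pow ω x
  pow-mod x = trans (reflexive (≡.cong (pow ω) (toℕ-fromℕ< (m%n<n x q)))) (pow-% x)

  pow-injective-< : ∀ {i j} → i < j → j < q → ¬ pow ω i ≈ pow ω j
  pow-injective-< {i} {j} i<j j<q ωⁱ≈ωʲ =
    proj₂ ω-primitive (j ∸ i) (m<n⇒0<n∸m i<j) (≤-<-trans (m∸n≤m j i) j<q) (*-cancelˡ (pow≉0 ω≉0 i) (begin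
      pow ω i * pow ω (j ∸ i)  ≈⟨ pow-+ ω i (j ∸ i) ⟨
      pow ω (i ℕ.+ (j ∸ i))    ≡⟨ ≡.cong (pow ω) (m+[n∸m]≡n (<⇒≤ i<j)) ⟩
      pow ω j                  ≈⟨ ωⁱ≈ωʲ ⟨
      pow ω i                  ≈⟨ *-identityʳ _ ⟨
      pow ω i * 1#             ∎))

  pow-injective : ∀ {i j : Fin q} → pow ω (toℕ i) ≈ pow ω (toℕ j) → i ≡ j
  pow-injective {i} {j} ωⁱ≈ωʲ with <-cmp (toℕ i) (toℕ j)
  ... | tri< i<j _ _   = ⊥-elim (pow-injective-< i<j (toℕ<n j) ωⁱ≈ωʲ)
  ... | tri≈ _ i≡j _   = toℕ-injective i≡j
  ... | tri> _ _ j<i   = ⊥-elim (pow-injective-< j<i (toℕ<n i) (sym ωⁱ≈ωʲ))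

  ω^h≈-1 : pow ω h ≈ - 1#
  ω^h≈-1 with proj₂ domain (y + 1#) (y - 1#) [y+1][y-1]≈0
    where
    y : Carrier
    y = pow ω h
    y²≈1 : y * y ≈ 1#
    y²≈1 = trans (sym (pow-+ ω h h)) (trans (reflexive (≡.cong (pow ω) (≡.sym q≡h+h))) (proj₁ ω-primitive))
    [y+1][y-1]≈0 : (y + 1#) * (y - 1#) ≈ 0#
    [y+1][y-1]≈0 = begin
      (y + 1#) * (y - 1#)               ≈⟨ x[y-z]≈xy-xz (y + 1#) y 1# ⟩
      (y + 1#) * y - (y + 1#) * 1#      ≈⟨ +-cong (distribʳ y y 1#) (-‿cong (*-identityʳ _)) ⟩
      (y * y + 1# * y) - (y + 1#)       ≈⟨ +-cong (+-cong y²≈1 (*-identityˡ y)) refl ⟩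
      (1# + y) - (y + 1#)               ≈⟨ +-cong (+-comm 1# y) refl ⟩
      (y + 1#) - (y + 1#)               ≈⟨ -‿inverseʳ _ ⟩
      0#                                ∎
  ... | inj₁ y+1≈0 = x∙y⁻¹≈ε⇒x≈y (pow ω h) (- 1#) (trans (+-cong refl (-‿involutive 1#)) y+1≈0)
  ... | inj₂ y-1≈0 = ⊥-elim (proj₂ ω-primitive h 1≤h h<q (x∙y⁻¹≈ε⇒x≈y (pow ω h) 1# y-1≈0))
    where
    h<q : h < q
    h<q = ≡.subst (h <_) (≡.sym q≡h+h) (m<m+n h 1≤h)

  sgn≈pow : ∀ b → sgn b ≈ pow ω (h ℕ.* b2n b)
  sgn≈pow false = reflexive (≡.cong (pow ω) (≡.sym (ℕ.*-zeroʳ h)))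
  sgn≈pow true  = sym (trans (reflexive (≡.cong (pow ω) (ℕ.*-identityʳ h))) ω^h≈-1)

  pow-mod-sgn : ∀ b k → pow ω (toℕ ((h ℕ.* b2n b ℕ.+ k) mod q)) ≈ sgn b * pow ω k
  pow-mod-sgn b k = begin
    pow ω (toℕ ((h ℕ.* b2n b ℕ.+ k) mod q))  ≈⟨ pow-mod (h ℕ.* b2n b ℕ.+ k) ⟩
    pow ω (h ℕ.* b2n b ℕ.+ k)                ≈⟨ pow-+ ω (h ℕ.* b2n b) k ⟩
    pow ω (h ℕ.* b2n b) * pow ω k            ≈⟨ *-cong (sgn≈pow b) refl ⟨
    sgn b * pow ω k                     ∎

  IsSelfDual⇔IsSignedDual : ∀ {m} {f : Fun2 m q} → IsSelfDual ω f ⇔ IsSignedDual ω false f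
  IsSelfDual⇔IsSignedDual = mk⇔
    (λ f-dual u v → trans (f-dual u v) (*-cong refl (sym (*-identityʳ _))))
    (λ f-dual u v → trans (f-dual u v) (*-cong refl (*-identityʳ _)))

  IsAntiSelfDual⇔IsSignedDual : ∀ {m} {f : Fun2 m q} → IsAntiSelfDual q h ω f ⇔ IsSignedDual ω true f
  IsAntiSelfDual⇔IsSignedDual {f = f} = mk⇔
    (λ f-dual u v → trans (f-dual u v) (*-cong refl (shift u v)))
    (λ f-dual u v → trans (f-dual u v) (*-cong refl (sym (shift u v))))
    where
    shift : ∀ u v → pow ω (toℕ ((toℕ (f u v) ℕ.+ h) mod q)) ≈ pow ω (toℕ (f u v)) * sgn true
    shift u v = trans (pow-mod _) (trans (pow-+ ω (toℕ (f u v)) h) (*-cong refl ω^h≈-1))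

module MaioranaMcFarland {c ℓ} (R : CommutativeRing c ℓ) (domain : WithRing.IsCharZeroDomain R)
       (q h : ℕ) .{{_ : NonZero q}} (q≡h+h : q ≡ h ℕ.+ h) (1≤h : 1 ≤ h)
       (ω : CommutativeRing.Carrier R) (ω-primitive : WithRing.IsPrimitiveRoot R q ω) where
  open F₂LinearAlgebra
  open Counting
  open OrthogonalMatrices
  open import Data.Bool using (Bool; true; false)
  open import Data.Nat using (suc; _^_; _∸_)
  open import Data.Nat.DivMod using (_mod_)
  open import Data.Fin using (Fin; toℕ)
  open import Data.Product using (Σ; ∃; _×_; _,_; proj₁; proj₂; map₁)
  open import Data.Product.Relation.Binary.Pointwise.NonDependent using (Pointwise)
  open import Function using (Bijective; Equivalence)
  open import Function.Consequences.Propositional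
    using (inverseᵇ⇒bijective; strictlyInverseˡ⇒inverseˡ; strictlyInverseʳ⇒inverseʳ)
  open import Relation.Nullary using (¬_)
  open import Relation.Binary.PropositionalEquality as ≡ using (_≡_)
  open CommutativeRing R
  open WithRing R
  open CharacterSums R using (MMForm)
  open IntegralDomain R domain
  open SignedDuality R domain
  open PrimitiveRoot R domain q h q≡h+h 1≤h ω ω-primitive
  open import Relation.Binary.Reasoning.Setoid setoid

  -- The parameter (c , a) , L stands for f(x, y) = (q/2)⟨x, L y + a⟩ + c + (q/2)⟨L y + a, a⟩.
  Parameter : ℕ → Set
  Parameter m = (Fin q × F2 m) × Mat m

  _≈ₚ_ : ∀ {m} → Parameter m → Parameter m → Set
  _≈ₚ_ = Pointwise (Pointwise _≡_ _≡_) _≐_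

  IsAdmissible : ∀ {m} → Bool → Parameter m → Set
  IsAdmissible e ((c , a) , L) = ⟨ a , a ⟩ ≡ e × IsOrthogonal L

  πₚ : ∀ {m} → Parameter m → F2 m → F2 m
  πₚ ((c , a) , L) y = L ▹ y ⊕ a

  gₚ : ∀ {m} → Parameter m → F2 m → Fin q
  gₚ p@((c , a) , L) y = (h ℕ.* b2n ⟨ πₚ p y , a ⟩ ℕ.+ toℕ c) mod q

  Φ : ∀ {m} → Parameter m → Fun2 m q
  Φ p x y = (h ℕ.* b2n ⟨ x , πₚ p y ⟩ ℕ.+ toℕ (gₚ p y)) mod q

  Gₚ : ∀ {m} → Parameter m → F2 m → Carrier
  Gₚ p@((c , a) , L) y = sgn ⟨ πₚ p y , a ⟩ * pow ω (toℕ c)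

  Gₚ≉0 : ∀ {m} (p : Parameter m) y → ¬ Gₚ p y ≈ 0#
  Gₚ≉0 ((c , a) , L) y = *-≉0 (sgn≉0 _) (pow≉0 ω≉0 (toℕ c))

  Φ-MMForm : ∀ {m} (p : Parameter m) → MMForm ω (Φ p) (πₚ p) (Gₚ p)
  Φ-MMForm p@((c , a) , L) x y = trans (pow-mod-sgn _ _) (*-cong refl (pow-mod-sgn _ _))

  πₚ-0ᵥ : ∀ {m} (p : Parameter m) → πₚ p 0ᵥ ≡ proj₂ (proj₁ p)
  πₚ-0ᵥ ((c , a) , L) = ≡.trans (≡.cong (_⊕ a) (▹-zeroʳ L)) (⊕-identityˡ a)

  Φ-cong : ∀ {m} {p p′ : Parameter m} → p ≈ₚ p′ → Φ p ≗₂ Φ p′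
  Φ-cong {p = (c , a) , L} ((≡.refl , ≡.refl) , L≐L′) x y =
    ≡.cong (λ t → (h ℕ.* b2n ⟨ x , t ⊕ a ⟩ ℕ.+ toℕ ((h ℕ.* b2n ⟨ t ⊕ a , a ⟩ ℕ.+ toℕ c) mod q)) mod q)
           (▹-cong L≐L′ y)

  Φ-injective : ∀ {m} (p p′ : Parameter m) → Φ p ≗₂ Φ p′ → p ≈ₚ p′
  Φ-injective p p′ Φp≗Φp′ = parameters-determined p p′ (λ y → proj₁ (same y)) (λ y → proj₂ (same y))
    where
    same : ∀ y → πₚ p y ≡ πₚ p′ y × Gₚ p y ≈ Gₚ p′ y
    same = sgn-MM-injective (Gₚ≉0 p) (λ x y → begin
      sgn ⟨ x , πₚ p y ⟩ * Gₚ p y     ≈⟨ Φ-MMForm p x y ⟨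
      pow ω (toℕ (Φ p x y))           ≡⟨ ≡.cong (λ k → pow ω (toℕ k)) (Φp≗Φp′ x y) ⟩
      pow ω (toℕ (Φ p′ x y))          ≈⟨ Φ-MMForm p′ x y ⟩
      sgn ⟨ x , πₚ p′ y ⟩ * Gₚ p′ y   ∎)
    parameters-determined : ∀ {m} (p p′ : Parameter m) →
      (∀ y → πₚ p y ≡ πₚ p′ y) → (∀ y → Gₚ p y ≈ Gₚ p′ y) → p ≈ₚ p′
    parameters-determined p@((c , a) , L) p′@((c′ , a′) , L′) π≗π′ G≈G′
      with ≡.trans (≡.sym (πₚ-0ᵥ p)) (≡.trans (π≗π′ 0ᵥ) (πₚ-0ᵥ p′))
    ... | ≡.refl = (c≡c′ , ≡.refl) , ≐-from-▹ (λ y → ⊕-cancelʳ-≡ a (π≗π′ y))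
      where
      c≡c′ : c ≡ c′
      c≡c′ = pow-injective (*-cancelˡ (sgn≉0 ⟨ πₚ p 0ᵥ , a ⟩) (begin
        sgn ⟨ πₚ p 0ᵥ , a ⟩ * pow ω (toℕ c)    ≈⟨ G≈G′ 0ᵥ ⟩
        sgn ⟨ πₚ p′ 0ᵥ , a ⟩ * pow ω (toℕ c′)  ≡⟨ ≡.cong (λ z → sgn ⟨ z , a ⟩ * pow ω (toℕ c′)) (π≗π′ 0ᵥ) ⟨
        sgn ⟨ πₚ p 0ᵥ , a ⟩ * pow ω (toℕ c′)   ∎))

  Φ-admissible : ∀ {m} e (p : Parameter m) → IsAdmissible e p → IsSignedDual ω e (Φ p) × IsGMM q h (Φ p)
  Φ-admissible {m} e p@((c , a) , L) (⟨a,a⟩≡e , L-orth) =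
    Equivalence.from (IsSignedDual⇔DualityCondition {ω = ω} {f = Φ p} e (Φ-MMForm p) πₚ-bijective) condition ,
    πₚ p , πₚ-bijective , gₚ p , λ x y → ≡.refl
    where
    πₚ-bijective : Bijective _≡_ _≡_ (πₚ p)
    πₚ-bijective = inverseᵇ⇒bijective
      ( strictlyInverseˡ⇒inverseˡ {f⁻¹ = π⁻¹} (πₚ p)
          (λ y → ≡.trans (≡.cong (_⊕ a) (orthogonal-▹-transpose-inverse L-orth (y ⊕ a))) (⊕-cancelʳ y a))
      , strictlyInverseʳ⇒inverseʳ (πₚ p)
          (λ x → ≡.trans (≡.cong (transpose L ▹_) (⊕-cancelʳ (L ▹ x) a))
                         (orthogonal-transpose-▹-inverse L-orth x)))
      where
      π⁻¹ : F2 m → F2 m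
      π⁻¹ y = transpose L ▹ (y ⊕ a)
    isometry : ∀ w v → ⟨ πₚ p w ⊕ a , πₚ p v ⊕ a ⟩ ≡ ⟨ w , v ⟩
    isometry w v =
      ≡.trans (≡.cong₂ ⟨_,_⟩ (⊕-cancelʳ (L ▹ w) a) (⊕-cancelʳ (L ▹ v) a)) (orthogonal-preserves-⟨⟩ L-orth w v)
    condition : DualityCondition e (πₚ p) (Gₚ p)
    condition = Equivalence.from (DualityCondition⇔SignCondition {π = πₚ p} (pow≉0 ω≉0 (toℕ c)) (λ w → refl))
                  (Equivalence.from (SignCondition⇔isometry {π = πₚ p} ⟨a,a⟩≡e) isometry)

  GMM-MMForm : ∀ {m} {f : Fun2 m q} {π : F2 m → F2 m} {g : F2 m → Fin q} →
    (∀ x y → f x y ≡ (h ℕ.* b2n ⟨ x , π y ⟩ ℕ.+ toℕ (g y)) mod q) →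
    MMForm ω f π (λ y → pow ω (toℕ (g y)))
  GMM-MMForm f≡ x y = trans (reflexive (≡.cong (λ k → pow ω (toℕ k)) (f≡ x y))) (pow-mod-sgn _ _)

  signed-dual-GMM-shape : ∀ {m} e {f : Fun2 m q} {π : F2 m → F2 m} {g : F2 m → Fin q} →
    IsSignedDual ω e f → Bijective _≡_ _≡_ π →
    (∀ x y → f x y ≡ (h ℕ.* b2n ⟨ x , π y ⟩ ℕ.+ toℕ (g y)) mod q) →
    ⟨ π 0ᵥ , π 0ᵥ ⟩ ≡ e ×
    (∀ w → pow ω (toℕ (g w)) ≈ sgn ⟨ π w , π 0ᵥ ⟩ * (pow ω (toℕ (g 0ᵥ)) * sgn e)) ×
    (∀ w v → ⟨ π w ⊕ π 0ᵥ , π v ⊕ π 0ᵥ ⟩ ≡ ⟨ w , v ⟩)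
  signed-dual-GMM-shape e {f} {π} {g} f-dual π-bijective f≡ =
    SignCondition⇒⟨a,a⟩≡e {π = π} sign-condition ,
    G-shape ,
    Equivalence.to (SignCondition⇔isometry {π = π} (SignCondition⇒⟨a,a⟩≡e {π = π} sign-condition)) sign-condition
    where
    condition : DualityCondition e π (λ y → pow ω (toℕ (g y)))
    condition = Equivalence.to (IsSignedDual⇔DualityCondition {ω = ω} {f = f} e (GMM-MMForm f≡) π-bijective) f-dual
    G-shape : ∀ w → pow ω (toℕ (g w)) ≈ sgn ⟨ π w , π 0ᵥ ⟩ * (pow ω (toℕ (g 0ᵥ)) * sgn e)
    G-shape = DualityCondition⇒shape {π = π} condition
    sign-condition : SignCondition e π (π 0ᵥ)
    sign-condition = Equivalence.to
      (DualityCondition⇔SignCondition {π = π} (*-≉0 (pow≉0 ω≉0 (toℕ (g 0ᵥ))) (sgn≉0 e)) G-shape) condition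

  admissible-Φ : ∀ {m} e (f : Fun2 m q) → IsSignedDual ω e f × IsGMM q h f →
    ∃ λ p → IsAdmissible e p × f ≗₂ Φ p
  admissible-Φ {m} e f (f-dual , π , π-bijective , g , f≡) =
    p , (⟨a,a⟩≡e , isometry⇒orthogonal φ ψ φ∘ψ φ-isometry ψ∘φ) , f≗Φp
    where
    a : F2 m
    a = π 0ᵥ
    ⟨a,a⟩≡e : ⟨ a , a ⟩ ≡ e
    ⟨a,a⟩≡e = proj₁ (signed-dual-GMM-shape e f-dual π-bijective f≡)
    g-shape : ∀ w → pow ω (toℕ (g w)) ≈ sgn ⟨ π w , a ⟩ * (pow ω (toℕ (g 0ᵥ)) * sgn e)
    g-shape = proj₁ (proj₂ (signed-dual-GMM-shape e f-dual π-bijective f≡))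
    φ ψ : F2 m → F2 m
    φ y = π y ⊕ a
    ψ z = proj₁ (proj₂ π-bijective (z ⊕ a))
    φ∘ψ : ∀ z → φ (ψ z) ≡ z
    φ∘ψ z = ≡.trans (≡.cong (_⊕ a) (proj₂ (proj₂ π-bijective (z ⊕ a)) ≡.refl)) (⊕-cancelʳ z a)
    ψ∘φ : ∀ y → ψ (φ y) ≡ y
    ψ∘φ y = proj₁ π-bijective (≡.trans (proj₂ (proj₂ π-bijective (φ y ⊕ a)) ≡.refl) (⊕-cancelʳ (π y) a))
    φ-isometry : ∀ w v → ⟨ φ w , φ v ⟩ ≡ ⟨ w , v ⟩
    φ-isometry = proj₂ (proj₂ (signed-dual-GMM-shape e f-dual π-bijective f≡))
    c₀ : Fin q
    c₀ = (h ℕ.* b2n e ℕ.+ toℕ (g 0ᵥ)) mod q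
    p : Parameter m
    p = (c₀ , a) , matrixOf φ
    πₚ≡π : ∀ y → πₚ p y ≡ π y
    πₚ≡π y = ≡.trans (≡.cong (_⊕ a) (isometry-matrixOf-▹ φ ψ φ∘ψ φ-isometry y)) (⊕-cancelʳ (π y) a)
    f≗Φp : f ≗₂ Φ p
    f≗Φp x y = pow-injective (begin
      pow ω (toℕ (f x y))
        ≈⟨ GMM-MMForm f≡ x y ⟩
      sgn ⟨ x , π y ⟩ * pow ω (toℕ (g y))
        ≈⟨ *-cong refl (g-shape y) ⟩
      sgn ⟨ x , π y ⟩ * (sgn ⟨ π y , a ⟩ * (pow ω (toℕ (g 0ᵥ)) * sgn e))
        ≈⟨ *-cong refl (*-cong refl (*-comm _ _)) ⟩
      sgn ⟨ x , π y ⟩ * (sgn ⟨ π y , a ⟩ * (sgn e * pow ω (toℕ (g 0ᵥ))))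
        ≈⟨ *-cong refl (*-cong refl (pow-mod-sgn e (toℕ (g 0ᵥ)))) ⟨
      sgn ⟨ x , π y ⟩ * (sgn ⟨ π y , a ⟩ * pow ω (toℕ c₀))
        ≡⟨ ≡.cong (λ z → sgn ⟨ x , z ⟩ * (sgn ⟨ z , a ⟩ * pow ω (toℕ c₀))) (πₚ≡π y) ⟨
      sgn ⟨ x , πₚ p y ⟩ * Gₚ p y
        ≈⟨ Φ-MMForm p x y ⟨
      pow ω (toℕ (Φ p x y)) ∎)

  HasCard-signed-dual-GMM : ∀ k e {N} → HasCard (_≐_ {suc k}) IsOrthogonal N →
    HasCard (_≗₂_ {suc k} {q}) (λ f → IsSignedDual ω e f × IsGMM q h f) (q ℕ.* 2 ^ k ℕ.* N)
  HasCard-signed-dual-GMM k e orthogonal-card =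
    HasCard-map (λ f≗g g≗k x y → ≡.trans (f≗g x y) (g≗k x y)) Φ
      (λ {p} → Φ-admissible e p) (λ {p} {p′} _ _ → Φ-injective p p′) Φ-cong (λ {f} → admissible-Φ e f)
      (HasCard-⇔ {_≈_ = _≈ₚ_}
        (λ ((_ , ⟨a,a⟩≡e) , L-orth) → ⟨a,a⟩≡e , L-orth) (λ (⟨a,a⟩≡e , L-orth) → (_ , ⟨a,a⟩≡e) , L-orth)
        (HasCard-× {_≈A_ = Pointwise _≡_ _≡_} {_≈B_ = _≐_}
          (HasCard-× {_≈A_ = _≡_} {_≈B_ = _≡_} (HasCard-Fin q) (HasCard-⟨⟩-diagonal k e)) orthogonal-card))

  HasCard-self-dual-GMM : ∀ m → 1 ≤ m → Σ ℕ λ N →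
    HasCard (_≐_ {m}) IsOrthogonal N ×
    HasCard (_≗₂_ {m} {q}) (λ f → IsSelfDual ω f × IsGMM q h f) (q ℕ.* 2 ^ (m ∸ 1) ℕ.* N) ×
    HasCard (_≗₂_ {m} {q}) (λ f → IsAntiSelfDual q h ω f × IsGMM q h f) (q ℕ.* 2 ^ (m ∸ 1) ℕ.* N)
  HasCard-self-dual-GMM (suc k) _ =
    let (N , orthogonal-card) = HasCard-orthogonal (suc k) in
    N , orthogonal-card ,
    HasCard-⇔ {_≈_ = _≗₂_}
      (λ {f} → map₁ (Equivalence.from (IsSelfDual⇔IsSignedDual {f = f})))
      (λ {f} → map₁ (Equivalence.to (IsSelfDual⇔IsSignedDual {f = f})))
      (HasCard-signed-dual-GMM k false orthogonal-card) ,
    HasCard-⇔ {_≈_ = _≗₂_}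
      (λ {f} → map₁ (Equivalence.from (IsAntiSelfDual⇔IsSignedDual {f = f})))
      (λ {f} → map₁ (Equivalence.to (IsAntiSelfDual⇔IsSignedDual {f = f})))
      (HasCard-signed-dual-GMM k true orthogonal-card)

open import Data.Nat using (_+_; _*_; _^_; _∸_; _/_)
open import Data.Nat.Properties using (*-comm; +-identityʳ)
open import Data.Nat.DivMod using (m/n*n≡m; m≥n⇒m/n>0)
open import Data.Nat.Divisibility using (_∣_)
open import Data.Product using (Σ; _×_)
open import Relation.Binary.PropositionalEquality using (sym; trans; cong)

n≡n/2+n/2 : ∀ {n} → 2 ∣ n → n ≡ n / 2 + n / 2
n≡n/2+n/2 {n} 2∣n =
  sym (trans (cong (n / 2 +_) (sym (+-identityʳ (n / 2)))) (trans (*-comm 2 (n / 2)) (m/n*n≡m 2∣n)))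

corollary1 : ∀ {c ℓ} (R : CommutativeRing c ℓ) (q n : ℕ) .{{_ : NonZero q}} →
    2 ≤ q → 2 ∣ q → 2 ≤ n → 2 ∣ n →
    (ω : CommutativeRing.Carrier R) →
    WithRing.IsCharZeroDomain R → WithRing.IsPrimitiveRoot R q ω →
    Σ ℕ λ N →
      HasCard (_≐_ {n / 2}) IsOrthogonal N ×
      HasCard (_≗₂_ {n / 2} {q}) (WithRing.SBplus R (n / 2) q ω) (q * 2 ^ (n / 2 ∸ 1) * N) ×
      HasCard (_≗₂_ {n / 2} {q}) (WithRing.SBminus R (n / 2) q ω) (q * 2 ^ (n / 2 ∸ 1) * N)
corollary1 R q n 2≤q 2∣q 2≤n 2∣n ω domain ω-primitive = HasCard-self-dual-GMM (n / 2) (m≥n⇒m/n>0 2≤n)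
  where open MaioranaMcFarland R domain q (q / 2) (n≡n/2+n/2 2∣q) (m≥n⇒m/n>0 2≤q) ω ω-primitive
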